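{- Let $C_n$ be the cycle with $n\ge 3$ vertices. Then $S(C_n)$, $Q(C_n)$ and $R(C_n)$ are dispersable. Moreover, $T(C_n)$ is nearly dispersable, i.e. $\operatorname{mbt}(T(C_n))=\Delta(T(C_n))+1$.
   Context: Matching book embedding: the vertices are placed in a linear order along a spine and each edge is assigned to a page (half-plane bounded by the spine) so that no two edges on the same page cross and every vertex is incident with at most one edge on each page. $\operatorname{mbt}(G)$ is the minimum number of pages of a matching book embedding of $G$. $G$ is dispersable if $\operatorname{mbt}(G)=\Delta(G)$, and nearly dispersable if $\operatorname{mbt}(G)=\Delta(G)+1$, where $\Delta$ denotes maximum degree. For a graph $G$: $S(G)$ is obtained by inserting a new vertex into each edge of $G$. $R(G)$ is obtained from $G$ by adding, for each edge $uv$, a new vertex adjacent to $u$ and $v$; the original edges are kept. $Q(G)$ is obtained by inserting a new vertex into each edge of $G$ and joining two new vertices whenever their edges share an endpoint. $T(G)$ has vertex set $V(G)\cup E(G)$, with adjacency meaning adjacency or incidence of the corresponding elements of $G$. -}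

module Defs where

open import Data.Nat using (ℕ; zero; suc; _+_; _⊔_; _≤_; _<_; _<ᵇ_)
open import Data.Nat.DivMod using (_mod_)
open import Data.Fin using (Fin; toℕ; _↑ˡ_; _↑ʳ_; _≟_)
open import Data.List using (List; []; _∷_; _++_; map; length; lookup; allFin; concatMap; filterᵇ; cartesianProduct; foldr)
open import Data.Product using (_×_; _,_; proj₁; proj₂; Σ; ∃)
open import Data.Sum using (_⊎_)
open import Data.Bool using (Bool; _∨_; _∧_)
open import Relation.Nullary using (¬_)
open import Relation.Nullary.Decidable using (⌊_⌋)
open import Relation.Binary.PropositionalEquality using (_≡_; _≢_)
open import Function.Definitions using (Injective)

-- Finite simple graphs given by a vertex count and a list of edges.
-- (The constructions below always produce simple graphs, i.e. no loops
-- and no repeated edges, for the graphs the theorem is about.)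

record Graph : Set where
  constructor graph
  field
    nV    : ℕ
    edges : List (Fin nV × Fin nV)
open Graph public

nE : Graph → ℕ
nE G = length (edges G)

Edge : Graph → Set
Edge G = Fin (nE G)

ends : (G : Graph) → Edge G → Fin (nV G) × Fin (nV G)
ends G e = lookup (edges G) e

deg : (G : Graph) → Fin (nV G) → ℕ
deg G v = length (filterᵇ (λ p → ⌊ proj₁ p ≟ v ⌋ ∨ ⌊ proj₂ p ≟ v ⌋) (edges G))

Δ : Graph → ℕ
Δ G = foldr _⊔_ 0 (map (deg G) (allFin (nV G)))

ShareEnd : ∀ {n} → Fin n × Fin n → Fin n × Fin n → Set
ShareEnd (a , b) (c , d) = a ≡ c ⊎ a ≡ d ⊎ b ≡ c ⊎ b ≡ d

Cross : ∀ {n} → (Fin n → ℕ) → Fin n × Fin n → Fin n × Fin n → Set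
Cross pos (a , b) (c , d) = Interleave a b ⊎ Interleave b a
  where
  Interleave : _ → _ → Set
  Interleave x y = (pos x < pos c × pos c < pos y × pos y < pos d)
                 ⊎ (pos x < pos d × pos d < pos y × pos y < pos c)

record MBE (G : Graph) (k : ℕ) : Set where
  field
    pos     : Fin (nV G) → Fin (nV G)
    pos-inj : Injective _≡_ _≡_ pos
    page    : Edge G → Fin k
    noCross : ∀ e f → page e ≡ page f →
              ¬ Cross (λ v → toℕ (pos v)) (ends G e) (ends G f)
    matching : ∀ e f → e ≢ f → page e ≡ page f → ¬ ShareEnd (ends G e) (ends G f)

IsMBT : Graph → ℕ → Set
IsMBT G k = MBE G k × (∀ j → MBE G j → k ≤ j)

Dispersable : Graph → Set
Dispersable G = IsMBT G (Δ G)

NearlyDispersable : Graph → Set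
NearlyDispersable G = IsMBT G (suc (Δ G))

cycleEdges : (n : ℕ) → List (Fin n × Fin n)
cycleEdges zero    = []
cycleEdges (suc m) = map (λ i → i , (suc (toℕ i) mod suc m)) (allFin (suc m))

C : ℕ → Graph
C n = graph n (cycleEdges n)

-- Constructions.  New vertices (one per edge of G) are numbered after the
-- old ones: old vertex u ↦ u ↑ˡ nE G, new vertex of edge e ↦ nV G ↑ʳ e.

module _ (G : Graph) where
  private
    N = nV G + nE G
    old : Fin (nV G) → Fin N
    old u = u ↑ˡ nE G
    new : Edge G → Fin N
    new e = nV G ↑ʳ e

  subdivEdges : List (Fin N × Fin N)
  subdivEdges = concatMap (λ e → (old (proj₁ (ends G e)) , new e)
                               ∷ (new e , old (proj₂ (ends G e))) ∷ [])
                          (allFin (nE G))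

  oldEdges : List (Fin N × Fin N)
  oldEdges = map (λ p → old (proj₁ p) , old (proj₂ p)) (edges G)

  shareᵇ : Fin (nV G) × Fin (nV G) → Fin (nV G) × Fin (nV G) → Bool
  shareᵇ (a , b) (c , d) = ⌊ a ≟ c ⌋ ∨ ⌊ a ≟ d ⌋ ∨ ⌊ b ≟ c ⌋ ∨ ⌊ b ≟ d ⌋

  -- new e — new f for distinct edges e, f of G sharing an endpoint
  -- (each unordered pair listed once, with toℕ e < toℕ f)
  lineEdges : List (Fin N × Fin N)
  lineEdges = map (λ p → new (proj₁ p) , new (proj₂ p))
                  (filterᵇ (λ p → (toℕ (proj₁ p) <ᵇ toℕ (proj₂ p))
                                  ∧ shareᵇ (ends G (proj₁ p)) (ends G (proj₂ p)))
                           (cartesianProduct (allFin (nE G)) (allFin (nE G))))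

  S : Graph
  S = graph N subdivEdges

  R : Graph
  R = graph N (oldEdges ++ subdivEdges)

  Q : Graph
  Q = graph N (subdivEdges ++ lineEdges)

  T : Graph
  T = graph N (oldEdges ++ subdivEdges ++ lineEdges)

module Submission where

-- Put the vertices of T(C n) on the spine in the order 0, e₀, 1, e₁, …, n−1, e₍ₙ₋₁₎,
-- where eᵢ subdivides the cycle edge {i, i+1}. Every edge then joins spine neighbours
-- or jumps over exactly one vertex (cyclically), and can only be crossed by an edge
-- ending at that vertex. So the four edges belonging to the cycle edge i only conflict
-- with those of i and i ± 1, and a page assignment is a closed walk of length n in a
-- finite digraph of colourings of one index; closed walks of lengths 3, 4 and 5 through
-- a common colouring give every n ≥ 3 (with 2 pages for S, 4 for R and Q, 5 for T).
-- No embedding uses fewer pages than the maximum degree. For T with 4 pages, every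
-- vertex has degree 4, so each page is a non-crossing perfect matching of the spine and
-- joins positions of opposite parity, which the triangle 0, e₀, 1 rules out.

open import Defs
open import Data.Nat using (ℕ; zero; suc; _+_; _*_; _∸_; _≤_; _<_; _⊓_; _⊔_; z≤n; s≤s; z<s; _<ᵇ_; _<?_; parity)
open import Data.Nat.Properties
open import Data.Nat.DivMod using (_%_; _mod_; m%n<n; m<n⇒m%n≡m; n%n≡0)
open import Data.Nat.Induction using (<-wellFounded)
open import Data.Parity.Base using (Parity; 0ℙ; 1ℙ; _⁻¹)
open import Data.Parity.Properties using (suc-homo-⁻¹; ⁻¹-selfInverse; p≢p⁻¹)
open import Data.Fin as Fin using (Fin; toℕ; punchOut; _↑ˡ_; _↑ʳ_)
open import Data.Fin.Properties
  using ( all?; any?; injective⇒≤; punchOut-injective; toℕ-injective; toℕ-fromℕ<; toℕ<n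
        ; toℕ-↑ˡ; toℕ-↑ʳ; ↑ˡ-injective; ↑ʳ-injective )
  renaming (suc-injective to Fin-suc-injective)
open import Data.Fin.Patterns using (0F; 1F; 2F; 3F; 4F)
open import Data.List using (List; []; _∷_; _++_; map; length; lookup; allFin; tabulate; filterᵇ; foldr)
  renaming (cartesianProduct to _×ˡ_)
open import Data.List.Properties using (length-map; length-tabulate)
open import Data.List.Membership.Propositional using (_∈_)
open import Data.List.Membership.Propositional.Properties
open import Data.List.Relation.Unary.Any as Any using (here; there)
import Data.List.Relation.Unary.Any.Properties as Any
import Data.List.Relation.Unary.All as All
open import Data.List.Relation.Unary.All using ([]; _∷_)
import Data.List.Relation.Unary.All.Properties as All
open import Data.List.Relation.Unary.AllPairs using ([]; _∷_)
import Data.List.Relation.Unary.AllPairs.Properties as AllPairs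
open import Data.List.Relation.Unary.Unique.Propositional using (Unique)
import Data.List.Relation.Unary.Unique.Propositional.Properties as Unique
open import Data.List.Relation.Binary.Disjoint.Propositional using (Disjoint)
open import Data.Product using (_×_; _,_; proj₁; proj₂; Σ; ∃; ∃-syntax)
open import Data.Product.Properties using (,-injectiveˡ; ,-injectiveʳ)
open import Data.Sum as Sum using (_⊎_; inj₁; inj₂; [_,_]′)
open import Data.Bool as Bool using (Bool; true; false; _∧_; _∨_; if_then_else_) renaming (T to IsTrue)
import Data.Bool.Properties as Bool
open import Data.Empty using (⊥; ⊥-elim)
open import Function.Base using (_∘_; id)
open import Function.Bundles using (Equivalence)
open import Function.Definitions using (Injective)
open import Induction.WellFounded using (Acc; acc)
open import Relation.Binary.Definitions using (tri<; tri≈; tri>)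
open import Relation.Binary.PropositionalEquality
open import Relation.Nullary using (¬_; yes; no; Dec; ¬?; contradiction)
open import Relation.Nullary.Decidable using (True; T?; ⌊_⌋; toWitness; fromWitness; _×-dec_; _→-dec_)

private
  variable
    X : Set
    k : ℕ

injective⇒surjective : (f : Fin k → Fin k) → Injective _≡_ _≡_ f → ∀ y → ∃[ x ] f x ≡ y
injective⇒surjective {suc k} f f-inj y with any? (λ x → f x Fin.≟ y)
... | yes hit = hit
... | no miss = contradiction (injective⇒≤ punched-injective) (<-irrefl refl)
  where
    punched : Fin (suc k) → Fin k
    punched x = punchOut {i = y} {j = f x} (λ y≡fx → miss (x , sym y≡fx))
    punched-injective : Injective _≡_ _≡_ punched
    punched-injective {x} {x′} eq =
      f-inj (punchOut-injective (λ y≡fx → miss (x , sym y≡fx)) (λ y≡fx′ → miss (x′ , sym y≡fx′)) eq)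

Unique⇒lookup-injective : {xs : List X} → Unique xs → Injective _≡_ _≡_ (lookup xs)
Unique⇒lookup-injective (_ ∷ _)    {Fin.zero}  {Fin.zero}  _  = refl
Unique⇒lookup-injective (x∉ ∷ _)   {Fin.zero}  {Fin.suc j} eq = ⊥-elim (All.lookup x∉ (∈-lookup j) eq)
Unique⇒lookup-injective (x∉ ∷ _)   {Fin.suc i} {Fin.zero}  eq = ⊥-elim (All.lookup x∉ (∈-lookup i) (sym eq))
Unique⇒lookup-injective (_ ∷ uniq) {Fin.suc i} {Fin.suc j} eq = cong Fin.suc (Unique⇒lookup-injective uniq eq)

module _ (p : X → Bool) where

  filterᵇ-index : ∀ xs → Fin (length (filterᵇ p xs)) → Fin (length xs)
  filterᵇ-index (x ∷ xs) i with p x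
  filterᵇ-index (x ∷ xs) Fin.zero    | true  = Fin.zero
  filterᵇ-index (x ∷ xs) (Fin.suc i) | true  = Fin.suc (filterᵇ-index xs i)
  filterᵇ-index (x ∷ xs) i           | false = Fin.suc (filterᵇ-index xs i)

  filterᵇ-index-satisfies : ∀ xs i → IsTrue (p (lookup xs (filterᵇ-index xs i)))
  filterᵇ-index-satisfies (x ∷ xs) i with p x in px
  filterᵇ-index-satisfies (x ∷ xs) Fin.zero    | true rewrite px = _
  filterᵇ-index-satisfies (x ∷ xs) (Fin.suc i) | true  = filterᵇ-index-satisfies xs i
  filterᵇ-index-satisfies (x ∷ xs) i           | false = filterᵇ-index-satisfies xs i

  filterᵇ-index-injective : ∀ xs → Injective _≡_ _≡_ (filterᵇ-index xs)
  filterᵇ-index-injective (x ∷ xs) {i} {j} eq with p x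
  filterᵇ-index-injective (x ∷ xs) {Fin.zero}  {Fin.zero}  eq | true = refl
  filterᵇ-index-injective (x ∷ xs) {Fin.suc i} {Fin.suc j} eq | true =
    cong Fin.suc (filterᵇ-index-injective xs (Fin-suc-injective eq))
  filterᵇ-index-injective (x ∷ xs) {i} {j} eq | false = filterᵇ-index-injective xs (Fin-suc-injective eq)

  filterᵇ-position : ∀ xs (i : Fin (length xs)) → IsTrue (p (lookup xs i)) → Fin (length (filterᵇ p xs))
  filterᵇ-position (x ∷ xs) Fin.zero t with p x
  ... | true = Fin.zero
  filterᵇ-position (x ∷ xs) (Fin.suc i) t with p x
  ... | true  = Fin.suc (filterᵇ-position xs i t)
  ... | false = filterᵇ-position xs i t

  filterᵇ-position-injective : ∀ xs {i j} (ti : IsTrue (p (lookup xs i))) (tj : IsTrue (p (lookup xs j))) →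
                               filterᵇ-position xs i ti ≡ filterᵇ-position xs j tj → i ≡ j
  filterᵇ-position-injective (x ∷ xs) {Fin.zero} {Fin.zero} _ _ _ = refl
  filterᵇ-position-injective (x ∷ xs) {Fin.zero} {Fin.suc j} ti tj eq with p x
  filterᵇ-position-injective (x ∷ xs) {Fin.zero} {Fin.suc j} ti tj () | true
  filterᵇ-position-injective (x ∷ xs) {Fin.suc i} {Fin.zero} ti tj eq with p x
  filterᵇ-position-injective (x ∷ xs) {Fin.suc i} {Fin.zero} ti tj () | true
  filterᵇ-position-injective (x ∷ xs) {Fin.suc i} {Fin.suc j} ti tj eq with p x
  ... | true  = cong Fin.suc (filterᵇ-position-injective xs ti tj (Fin-suc-injective eq))
  ... | false = cong Fin.suc (filterᵇ-position-injective xs ti tj eq)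

lookup-map-tabulate : ∀ {Y : Set} {n} (g : Fin n → X) (f : X → Y) (e : Fin (length (map f (tabulate g)))) →
                      ∃[ i ] toℕ i ≡ toℕ e × lookup (map f (tabulate g)) e ≡ f (g i)
lookup-map-tabulate {n = suc n} g f Fin.zero    = Fin.zero , refl , refl
lookup-map-tabulate {n = suc n} g f (Fin.suc e) with lookup-map-tabulate (g ∘ Fin.suc) f e
... | i , i≡e , eq = Fin.suc i , cong suc i≡e , eq

⊓≡⊔⇒≡ : ∀ {m n} → m ⊓ n ≡ m ⊔ n → m ≡ n
⊓≡⊔⇒≡ {m} {n} eq = ≤-antisym (≤-trans (m≤m⊔n m n) (≤-trans (≤-reflexive (sym eq)) (m⊓n≤n m n)))
                             (≤-trans (m≤n⊔m m n) (≤-trans (≤-reflexive (sym eq)) (m⊓n≤m m n)))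

foldr-⊔-lub : ∀ {m} xs → (∀ {x} → x ∈ xs → x ≤ m) → foldr _⊔_ 0 xs ≤ m
foldr-⊔-lub []       _  = z≤n
foldr-⊔-lub (x ∷ xs) ≤m = ⊔-lub (≤m (here refl)) (foldr-⊔-lub xs (λ x∈ → ≤m (there x∈)))

foldr-⊔-upper : ∀ {x} xs → x ∈ xs → x ≤ foldr _⊔_ 0 xs
foldr-⊔-upper (y ∷ xs) (here refl) = m≤m⊔n y _
foldr-⊔-upper (y ∷ xs) (there x∈)  = ≤-trans (foldr-⊔-upper xs x∈) (m≤n⊔m y _)

-- Degrees in matching book embeddings

module _ (G : Graph) where

  Incident : Fin (nV G) → Fin (nV G) × Fin (nV G) → Set
  Incident v (a , b) = a ≡ v ⊎ b ≡ v

  incident⇒ShareEnd : ∀ {v x y} → Incident v x → Incident v y → ShareEnd x y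
  incident⇒ShareEnd (inj₁ refl) (inj₁ refl) = inj₁ refl
  incident⇒ShareEnd (inj₁ refl) (inj₂ refl) = inj₂ (inj₁ refl)
  incident⇒ShareEnd (inj₂ refl) (inj₁ refl) = inj₂ (inj₂ (inj₁ refl))
  incident⇒ShareEnd (inj₂ refl) (inj₂ refl) = inj₂ (inj₂ (inj₂ refl))

  ShareEnd⇒common : ∀ {x y} → ShareEnd x y → ∃[ v ] Incident v x × Incident v y
  ShareEnd⇒common (inj₁ refl)               = _ , inj₁ refl , inj₁ refl
  ShareEnd⇒common (inj₂ (inj₁ refl))        = _ , inj₁ refl , inj₂ refl
  ShareEnd⇒common (inj₂ (inj₂ (inj₁ refl))) = _ , inj₂ refl , inj₁ refl
  ShareEnd⇒common (inj₂ (inj₂ (inj₂ refl))) = _ , inj₂ refl , inj₂ refl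

  shareᵇ⇒ShareEnd : ∀ {x y} → IsTrue (shareᵇ G x y) → ShareEnd x y
  shareᵇ⇒ShareEnd {a , b} {c , d} t with a Fin.≟ c | a Fin.≟ d | b Fin.≟ c
  ... | yes a≡c | _       | _       = inj₁ a≡c
  ... | no _    | yes a≡d | _       = inj₂ (inj₁ a≡d)
  ... | no _    | no _    | yes b≡c = inj₂ (inj₂ (inj₁ b≡c))
  ... | no _    | no _    | no _    = inj₂ (inj₂ (inj₂ (toWitness t)))

  ShareEnd⇒shareᵇ : ∀ {x y} → ShareEnd x y → IsTrue (shareᵇ G x y)
  ShareEnd⇒shareᵇ {a , b} {c , d} share with a Fin.≟ c | a Fin.≟ d | b Fin.≟ c | share
  ... | yes _ | _     | _     | _ = _
  ... | no _  | yes _ | _     | _ = _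
  ... | no _  | no _  | yes _ | _ = _
  ... | no a≢c | no _    | no _    | inj₁ a≡c = ⊥-elim (a≢c a≡c)
  ... | no _   | no a≢d  | no _    | inj₂ (inj₁ a≡d) = ⊥-elim (a≢d a≡d)
  ... | no _   | no _    | no b≢c  | inj₂ (inj₂ (inj₁ b≡c)) = ⊥-elim (b≢c b≡c)
  ... | no _   | no _    | no _    | inj₂ (inj₂ (inj₂ b≡d)) = fromWitness b≡d

  Star : Fin (nV G) → ℕ → Set
  Star v r = Σ (Fin r → Edge G) λ es → Injective _≡_ _≡_ es × (∀ q → Incident v (ends G (es q)))

  ProperEdgeColouring : (Edge G → Fin k) → Set
  ProperEdgeColouring colour = ∀ e f → e ≢ f → colour e ≡ colour f → ¬ ShareEnd (ends G e) (ends G f)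

  private
    incidentᵇ : Fin (nV G) → Fin (nV G) × Fin (nV G) → Bool
    incidentᵇ v (a , b) = ⌊ a Fin.≟ v ⌋ ∨ ⌊ b Fin.≟ v ⌋

    incidentᵇ⇒Incident : ∀ v x → IsTrue (incidentᵇ v x) → Incident v x
    incidentᵇ⇒Incident v (a , b) t with a Fin.≟ v
    ... | yes a≡v = inj₁ a≡v
    ... | no _    = inj₂ (toWitness t)

    Incident⇒incidentᵇ : ∀ v x → Incident v x → IsTrue (incidentᵇ v x)
    Incident⇒incidentᵇ v (a , b) (inj₁ a≡v) rewrite a≡v with v Fin.≟ v
    ... | yes _   = _
    ... | no v≢v  = ⊥-elim (v≢v refl)
    Incident⇒incidentᵇ v (a , b) (inj₂ b≡v) with a Fin.≟ v
    ... | yes _ = _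
    ... | no _  = fromWitness b≡v

  deg≤colours : {colour : Edge G → Fin k} → ProperEdgeColouring colour → ∀ v → deg G v ≤ k
  deg≤colours {colour = colour} proper v = injective⇒≤ colour-injective
    where
      incidentEdge : Fin (deg G v) → Edge G
      incidentEdge = filterᵇ-index (incidentᵇ v) (edges G)
      incident : ∀ i → Incident v (ends G (incidentEdge i))
      incident i = incidentᵇ⇒Incident v _ (filterᵇ-index-satisfies (incidentᵇ v) (edges G) i)
      colour-injective : Injective _≡_ _≡_ (λ i → colour (incidentEdge i))
      colour-injective {i} {j} same with i Fin.≟ j
      ... | yes i≡j = i≡j
      ... | no i≢j  = ⊥-elim (proper _ _ (i≢j ∘ filterᵇ-index-injective (incidentᵇ v) (edges G)) same
                                (incident⇒ShareEnd (incident i) (incident j)))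

  Δ≤colours : {colour : Edge G → Fin k} → ProperEdgeColouring colour → Δ G ≤ k
  Δ≤colours proper = foldr-⊔-lub _ λ d∈ → bound (∈-map⁻ (deg G) d∈)
    where
      bound : ∀ {d} → ∃[ v ] v ∈ allFin (nV G) × d ≡ deg G v → d ≤ _
      bound (v , _ , refl) = deg≤colours proper v

  Δ≤pages : MBE G k → Δ G ≤ k
  Δ≤pages mb = Δ≤colours (MBE.matching mb)

  star≤Δ : ∀ {v r} → Star v r → r ≤ Δ G
  star≤Δ {v} (es , es-injective , incident) =
    ≤-trans (injective⇒≤ position-injective) (foldr-⊔-upper _ (∈-map⁺ (deg G) (∈-allFin v)))
    where
      position : Fin _ → Fin (deg G v)
      position q = filterᵇ-position (incidentᵇ v) (edges G) (es q) (Incident⇒incidentᵇ v _ (incident q))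
      position-injective : Injective _≡_ _≡_ position
      position-injective eq = es-injective (filterᵇ-position-injective (incidentᵇ v) (edges G) _ _ eq)

  mbe+star⇒dispersable : ∀ {v} → MBE G k → Star v k → Dispersable G
  mbe+star⇒dispersable {k = k} mb star = subst (MBE G) (sym Δ≡k) mb , λ _ → Δ≤pages
    where
      Δ≡k : Δ G ≡ k
      Δ≡k = ≤-antisym (Δ≤pages mb) (star≤Δ star)

  mbe+star+colouring⇒nearlyDispersable : ∀ {v} {colour : Edge G → Fin k} → MBE G (suc k) → Star v k →
    ProperEdgeColouring colour → ¬ MBE G k → NearlyDispersable G
  mbe+star+colouring⇒nearlyDispersable {k = k} mb star proper no-mbe =
    subst (MBE G) (cong suc (sym Δ≡k)) mb , more-than-Δ
    where
      Δ≡k : Δ G ≡ k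
      Δ≡k = ≤-antisym (Δ≤colours proper) (star≤Δ star)
      more-than-Δ : ∀ j → MBE G j → suc (Δ G) ≤ j
      more-than-Δ j mb′ rewrite Δ≡k = ≤∧≢⇒< (subst (_≤ j) Δ≡k (Δ≤pages mb′)) λ { refl → no-mbe mb′ }

-- Non-crossing perfect matchings

parity-suc : ∀ n → parity (suc n) ≡ parity n ⁻¹
parity-suc n = sym (⁻¹-selfInverse (suc-homo-⁻¹ n))

parity-suc-cong : ∀ {m n} → parity m ≡ parity n → parity (suc m) ≡ parity (suc n)
parity-suc-cong {m} {n} eq = trans (parity-suc m) (trans (cong _⁻¹ eq) (sym (parity-suc n)))

record NonCrossingPerfectMatching (N : ℕ) : Set₁ where
  field
    _~_         : ℕ → ℕ → Set
    total       : ∀ x → x < N → ∃ (x ~_)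
    bounded     : ∀ {x y} → x ~ y → y < N
    symmetric   : ∀ {x y} → x ~ y → y ~ x
    functional  : ∀ {x y z} → x ~ y → x ~ z → y ≡ z
    irreflexive : ∀ {x y} → x ~ y → x ≢ y
    noncrossing : ∀ {a b c d} → a ~ b → c ~ d → a < c → c < b → b < d → ⊥

module _ {N : ℕ} (M : NonCrossingPerfectMatching N) where
  open NonCrossingPerfectMatching M

  private
    Closed : ℕ → ℕ → Set
    Closed s t = ∀ {x y} → s ≤ x → x < t → x ~ y → s ≤ y × y < t

    inside-closed : ∀ {p q} → p ~ q → p < q → Closed (suc p) q
    inside-closed {p} {q} p~q p<q {x} {y} p<x x<q x~y with <-cmp y p | <-cmp y q
    ... | tri< y<p _ _ | _              = ⊥-elim (noncrossing (symmetric x~y) p~q y<p p<x x<q)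
    ... | tri≈ _ refl _ | _             = ⊥-elim (<⇒≢ x<q (functional (symmetric x~y) p~q))
    ... | tri> _ _ p<y | tri< y<q _ _   = p<y , y<q
    ... | tri> _ _ p<y | tri≈ _ refl _  = ⊥-elim (<⇒≢ p<x (functional (symmetric p~q) (symmetric x~y)))
    ... | tri> _ _ p<y | tri> _ _ q<y   = ⊥-elim (noncrossing p~q x~y p<x x<q q<y)

    -- s is matched to some r in the interval; both (s, r) and (r, t) are closed again.
    closed⇒parity : ∀ {s t} → Acc _<_ (t ∸ s) → Closed s t → s ≤ t → t ≤ N → parity s ≡ parity t
    closed⇒parity {s} {t} (acc smaller) closed s≤t t≤N with m≤n⇒m<n∨m≡n s≤t
    ... | inj₂ refl = refl
    ... | inj₁ s<t = trans (parity-suc-cong {suc s} {r} left) right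
      where
        r = proj₁ (total s (<-≤-trans s<t t≤N))
        s~r = proj₂ (total s (<-≤-trans s<t t≤N))
        s<r : s < r
        s<r = ≤∧≢⇒< (proj₁ (closed ≤-refl s<t s~r)) (irreflexive s~r)
        r<t : r < t
        r<t = proj₂ (closed ≤-refl s<t s~r)
        left : parity (suc s) ≡ parity r
        left = closed⇒parity (smaller (<-≤-trans (∸-monoʳ-< (n<1+n s) s<r) (∸-monoˡ-≤ s (<⇒≤ r<t))))
                             (inside-closed s~r s<r) s<r
                             (≤-trans (<⇒≤ r<t) t≤N)
        outside : Closed (suc r) t
        outside {x} {y} r<x x<t x~y with closed (≤-trans (<⇒≤ s<r) (<⇒≤ r<x)) x<t x~y
        ... | s≤y , y<t with <-cmp y r
        ... | tri> _ _ r<y = r<y , y<t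
        ... | tri≈ _ refl _ = ⊥-elim (<⇒≢ (<-trans s<r r<x) (sym (functional (symmetric x~y) (symmetric s~r))))
        ... | tri< y<r _ _ with m≤n⇒m<n∨m≡n s≤y
        ...   | inj₂ refl = ⊥-elim (<⇒≢ r<x (functional s~r (symmetric x~y)))
        ...   | inj₁ s<y  = ⊥-elim (<-irrefl refl (<-≤-trans r<x
                              (<⇒≤ (proj₂ (inside-closed s~r s<r s<y y<r (symmetric x~y))))))
        right : parity (suc r) ≡ parity t
        right = closed⇒parity (smaller (∸-monoʳ-< (<-trans s<r (n<1+n r)) r<t)) outside r<t t≤N

    matched-forward⇒opposite-parity : ∀ {p q} → p ~ q → p < q → parity p ≢ parity q
    matched-forward⇒opposite-parity {p} {q} p~q p<q same =
      p≢p⁻¹ (parity p) (trans same (trans (sym inside) (parity-suc p)))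
      where
        inside : parity (suc p) ≡ parity q
        inside = closed⇒parity (<-wellFounded _) (inside-closed p~q p<q) p<q (<⇒≤ (bounded p~q))

  matched⇒opposite-parity : ∀ {p q} → p ~ q → parity p ≢ parity q
  matched⇒opposite-parity {p} {q} p~q with <-cmp p q
  ... | tri< p<q _ _ = matched-forward⇒opposite-parity p~q p<q
  ... | tri≈ _ p≡q _ = ⊥-elim (irreflexive p~q p≡q)
  ... | tri> _ _ q<p = matched-forward⇒opposite-parity (symmetric p~q) q<p ∘ sym

module _ (G : Graph) {k} (mb : MBE G k) (star : ∀ v → Star G v k)
         (loopless : ∀ e → proj₁ (ends G e) ≢ proj₂ (ends G e)) where
  open MBE mb

  private
    spine : Fin (nV G) → ℕ
    spine v = toℕ (pos v)

    spine-injective : ∀ {u v} → spine u ≡ spine v → u ≡ v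
    spine-injective eq = pos-inj (toℕ-injective eq)

    every-page-at-every-vertex : ∀ v P → ∃[ e ] page e ≡ P × Incident G v (ends G e)
    every-page-at-every-vertex v P = es q , page≡P , incident q
      where
        es = proj₁ (star v)
        incident = proj₂ (proj₂ (star v))
        star-pages-injective : Injective _≡_ _≡_ (page ∘ es)
        star-pages-injective {q} {q′} same with q Fin.≟ q′
        ... | yes q≡q′ = q≡q′
        ... | no q≢q′  = ⊥-elim (matching _ _ (q≢q′ ∘ proj₁ (proj₂ (star v))) same
                                   (incident⇒ShareEnd G (incident q) (incident q′)))
        q = proj₁ (injective⇒surjective _ star-pages-injective P)
        page≡P = proj₂ (injective⇒surjective _ star-pages-injective P)

    Joins : Edge G → ℕ → ℕ → Set
    Joins e x y = (spine (proj₁ (ends G e)) ≡ x × spine (proj₂ (ends G e)) ≡ y)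
                ⊎ (spine (proj₁ (ends G e)) ≡ y × spine (proj₂ (ends G e)) ≡ x)

    endpoint-at : ∀ {e x y} → Joins e x y → ∃[ u ] spine u ≡ x × Incident G u (ends G e)
    endpoint-at (inj₁ (refl , _)) = _ , refl , inj₁ refl
    endpoint-at (inj₂ (_ , refl)) = _ , refl , inj₂ refl

    joins-functional : ∀ {e x y z} → Joins e x y → Joins e x z → y ≡ z
    joins-functional (inj₁ (_ , b)) (inj₁ (_ , d)) = trans (sym b) d
    joins-functional (inj₁ (a , b)) (inj₂ (c , d)) = trans (sym b) (trans d (trans (sym a) c))
    joins-functional (inj₂ (a , b)) (inj₁ (c , d)) = trans (sym a) (trans c (trans (sym b) d))
    joins-functional (inj₂ (a , _)) (inj₂ (c , _)) = trans (sym a) c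

    page-matching : Fin k → NonCrossingPerfectMatching (nV G)
    page-matching P = record
      { _~_         = _~_
      ; total       = total
      ; bounded     = bounded
      ; symmetric   = λ { (e , pe , inj₁ (a , b)) → e , pe , inj₂ (a , b)
                        ; (e , pe , inj₂ (a , b)) → e , pe , inj₁ (a , b) }
      ; functional  = functional
      ; irreflexive = λ { (e , _ , inj₁ (refl , refl)) same → loopless e (spine-injective same)
                        ; (e , _ , inj₂ (refl , refl)) same → loopless e (spine-injective (sym same)) }
      ; noncrossing = noncrossing
      }
      where
        _~_ : ℕ → ℕ → Set
        x ~ y = ∃[ e ] page e ≡ P × Joins e x y

        total : ∀ x → x < nV G → ∃ (x ~_)
        total x x<N with injective⇒surjective pos pos-inj (Fin.fromℕ< x<N)
        ... | v , pos-v with every-page-at-every-vertex v P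
        ...   | e , pe , inj₁ refl = _ , e , pe , inj₁ (spine≡x , refl)
          where spine≡x = trans (cong toℕ pos-v) (toℕ-fromℕ< x<N)
        ...   | e , pe , inj₂ refl = _ , e , pe , inj₂ (refl , spine≡x)
          where spine≡x = trans (cong toℕ pos-v) (toℕ-fromℕ< x<N)

        bounded : ∀ {x y} → x ~ y → y < nV G
        bounded (e , _ , inj₁ (_ , refl)) = toℕ<n _
        bounded (e , _ , inj₂ (refl , _)) = toℕ<n _

        functional : ∀ {x y z} → x ~ y → x ~ z → y ≡ z
        functional (e , pe , je) (f , pf , jf) with e Fin.≟ f
        ... | yes refl = joins-functional je jf
        ... | no e≢f with endpoint-at je | endpoint-at jf
        ...   | u , refl , u∈e | w , u≡w , w∈f =
          ⊥-elim (matching e f e≢f (trans pe (sym pf))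
                   (incident⇒ShareEnd G u∈e (subst (λ z → Incident G z (ends G f)) (spine-injective u≡w) w∈f)))

        crossing : ∀ {e f a b c d} → Joins e a b → Joins f c d → a < c → c < b → b < d →
                   Cross spine (ends G e) (ends G f)
        crossing (inj₁ (refl , refl)) (inj₁ (refl , refl)) a<c c<b b<d = inj₁ (inj₁ (a<c , c<b , b<d))
        crossing (inj₁ (refl , refl)) (inj₂ (refl , refl)) a<c c<b b<d = inj₁ (inj₂ (a<c , c<b , b<d))
        crossing (inj₂ (refl , refl)) (inj₁ (refl , refl)) a<c c<b b<d = inj₂ (inj₁ (a<c , c<b , b<d))
        crossing (inj₂ (refl , refl)) (inj₂ (refl , refl)) a<c c<b b<d = inj₂ (inj₂ (a<c , c<b , b<d))

        noncrossing : ∀ {a b c d} → a ~ b → c ~ d → a < c → c < b → b < d → ⊥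
        noncrossing (e , pe , je) (f , pf , jf) a<c c<b b<d =
          noCross e f (trans pe (sym pf)) (crossing je jf a<c c<b b<d)

  mbe-edge-opposite-parity : ∀ e → parity (spine (proj₁ (ends G e))) ≢ parity (spine (proj₂ (ends G e)))
  mbe-edge-opposite-parity e = matched⇒opposite-parity (page-matching (page e)) (e , refl , inj₁ (refl , refl))

  regular-mbe⇒no-triangle : ∀ e f g → proj₁ (ends G e) ≡ proj₁ (ends G g) → proj₂ (ends G e) ≡ proj₁ (ends G f) →
                            proj₂ (ends G f) ≡ proj₂ (ends G g) → ⊥
  regular-mbe⇒no-triangle e f g ae≡ag be≡af bf≡bg =
    two-colours (mbe-edge-opposite-parity e)
                (subst (λ v → parity (spine v) ≢ _) (sym be≡af) (mbe-edge-opposite-parity f))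
                (subst₂ (λ u v → parity (spine u) ≢ parity (spine v)) (sym ae≡ag) (sym bf≡bg) (mbe-edge-opposite-parity g))
    where
      two-colours : ∀ {x y z : Parity} → x ≢ y → y ≢ z → x ≢ z → ⊥
      two-colours {0ℙ} {0ℙ} x≢y _ _ = x≢y refl
      two-colours {1ℙ} {1ℙ} x≢y _ _ = x≢y refl
      two-colours {0ℙ} {1ℙ} {0ℙ} _ _ x≢z = x≢z refl
      two-colours {0ℙ} {1ℙ} {1ℙ} _ y≢z _ = y≢z refl
      two-colours {1ℙ} {0ℙ} {0ℙ} _ y≢z _ = y≢z refl
      two-colours {1ℙ} {0ℙ} {1ℙ} _ _ x≢z = x≢z refl

module _ {V : Set} (_⟶_ : V → V → Set) where

  data Walk : ℕ → V → V → Set where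
    []  : ∀ {x} → Walk 0 x x
    _∷_ : ∀ {x y z n} → x ⟶ y → Walk n y z → Walk (suc n) x z

  _++ʷ_ : ∀ {x y z m n} → Walk m x y → Walk n y z → Walk (m + n) x z
  []      ++ʷ w′ = w′
  (s ∷ w) ++ʷ w′ = s ∷ (w ++ʷ w′)

  vertexAt : ∀ {x y n} → Walk n x y → ℕ → V
  vertexAt {x} _       zero    = x
  vertexAt {x} []      (suc _) = x
  vertexAt     (_ ∷ w) (suc i) = vertexAt w i

  vertexAt-end : ∀ {x y n} (w : Walk n x y) → vertexAt w n ≡ y
  vertexAt-end []      = refl
  vertexAt-end (_ ∷ w) = vertexAt-end w

  vertexAt-step : ∀ {x y n} (w : Walk n x y) {i} → i < n → vertexAt w i ⟶ vertexAt w (suc i)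
  vertexAt-step (s ∷ _) {zero}  _         = s
  vertexAt-step (_ ∷ w) {suc i} (s≤s i<n) = vertexAt-step w i<n

  closedWalk-3+ : ∀ {x} → Walk 3 x x → Walk 4 x x → Walk 5 x x → ∀ k → Walk (3 + k) x x
  closedWalk-3+ w₃ w₄ w₅ 0 = w₃
  closedWalk-3+ w₃ w₄ w₅ 1 = w₄
  closedWalk-3+ w₃ w₄ w₅ 2 = w₅
  closedWalk-3+ w₃ w₄ w₅ (suc (suc (suc k))) = w₃ ++ʷ closedWalk-3+ w₃ w₄ w₅ k

-- Crossings on the spine

-- As Defs.Cross, this only detects crossings in which the first edge has the leftmost endpoint.
Between : ℕ → ℕ → ℕ → ℕ → Set
Between x y c d = (x < c × c < y × y < d) ⊎ (x < d × d < y × y < c)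

Crosses : ℕ × ℕ → ℕ × ℕ → Set
Crosses (a , b) (c , d) = Between a b c d ⊎ Between b a c d

¬Crosses-unit-left : ∀ p e → ¬ Crosses (p , suc p) e
¬Crosses-unit-left p e (inj₁ (inj₁ (p<c , c<1+p , _))) = <⇒≱ p<c (≤-pred c<1+p)
¬Crosses-unit-left p e (inj₁ (inj₂ (p<d , d<1+p , _))) = <⇒≱ p<d (≤-pred d<1+p)
¬Crosses-unit-left p e (inj₂ (inj₁ (1+p<c , c<p , _))) = <-asym (<-trans (n<1+n p) 1+p<c) c<p
¬Crosses-unit-left p e (inj₂ (inj₂ (1+p<d , d<p , _))) = <-asym (<-trans (n<1+n p) 1+p<d) d<p

¬Crosses-unit-right : ∀ e u → ¬ Crosses e (u , suc u)
¬Crosses-unit-right e u (inj₁ (inj₁ (_ , u<y , y<1+u))) = <⇒≱ u<y (≤-pred y<1+u)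
¬Crosses-unit-right e u (inj₁ (inj₂ (_ , 1+u<y , y<u))) = <-asym (<-trans (n<1+n u) 1+u<y) y<u
¬Crosses-unit-right e u (inj₂ (inj₁ (_ , u<y , y<1+u))) = <⇒≱ u<y (≤-pred y<1+u)
¬Crosses-unit-right e u (inj₂ (inj₂ (_ , 1+u<y , y<u))) = <-asym (<-trans (n<1+n u) 1+u<y) y<u

¬Crosses-zero-right : ∀ e c → ¬ Crosses e (c , 0)
¬Crosses-zero-right e c (inj₁ (inj₁ (_ , _ , ())))
¬Crosses-zero-right e c (inj₁ (inj₂ (() , _ , _)))
¬Crosses-zero-right e c (inj₂ (inj₁ (_ , _ , ())))
¬Crosses-zero-right e c (inj₂ (inj₂ (() , _ , _)))

¬Crosses-from-max : ∀ {p q c d H} → p ≤ H → q ≤ H → c ≤ H → d ≤ H → p ≡ H ⊎ q ≡ H →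
                    ¬ Crosses (p , q) (c , d)
¬Crosses-from-max _ _ c≤H d≤H (inj₁ refl) (inj₁ (inj₁ (H<c , _ , _))) = <⇒≱ H<c c≤H
¬Crosses-from-max _ _ c≤H d≤H (inj₁ refl) (inj₁ (inj₂ (H<d , _ , _))) = <⇒≱ H<d d≤H
¬Crosses-from-max _ _ c≤H d≤H (inj₁ refl) (inj₂ (inj₁ (_ , _ , H<d))) = <⇒≱ H<d d≤H
¬Crosses-from-max _ _ c≤H d≤H (inj₁ refl) (inj₂ (inj₂ (_ , _ , H<c))) = <⇒≱ H<c c≤H
¬Crosses-from-max _ _ c≤H d≤H (inj₂ refl) (inj₁ (inj₁ (_ , _ , H<d))) = <⇒≱ H<d d≤H
¬Crosses-from-max _ _ c≤H d≤H (inj₂ refl) (inj₁ (inj₂ (_ , _ , H<c))) = <⇒≱ H<c c≤H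
¬Crosses-from-max _ _ c≤H d≤H (inj₂ refl) (inj₂ (inj₁ (H<c , _ , _))) = <⇒≱ H<c c≤H
¬Crosses-from-max _ _ c≤H d≤H (inj₂ refl) (inj₂ (inj₂ (H<d , _ , _))) = <⇒≱ H<d d≤H

Crosses-span-two : ∀ p c d → Crosses (p , suc (suc p)) (c , d) → c ≡ suc p ⊎ d ≡ suc p
Crosses-span-two p c d (inj₁ (inj₁ (p<c , c<2+p , _))) = inj₁ (≤-antisym (≤-pred c<2+p) p<c)
Crosses-span-two p c d (inj₁ (inj₂ (p<d , d<2+p , _))) = inj₂ (≤-antisym (≤-pred d<2+p) p<d)
Crosses-span-two p c d (inj₂ (inj₁ (2+p<c , c<p , _))) = ⊥-elim (<-asym (<-trans (m<n+m p z<s) 2+p<c) c<p)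
Crosses-span-two p c d (inj₂ (inj₂ (2+p<d , d<p , _))) = ⊥-elim (<-asym (<-trans (m<n+m p z<s) 2+p<d) d<p)

Crosses-wrap : ∀ q c d → c ≤ suc q → d ≤ suc q → Crosses (q , 0) (c , d) → c ≡ suc q ⊎ d ≡ suc q
Crosses-wrap q c d _   _   (inj₁ (inj₁ (_ , () , _)))
Crosses-wrap q c d _   _   (inj₁ (inj₂ (_ , () , _)))
Crosses-wrap q c d _   d≤ (inj₂ (inj₁ (_ , _ , q<d))) = inj₂ (≤-antisym d≤ q<d)
Crosses-wrap q c d c≤ _   (inj₂ (inj₂ (_ , _ , q<c))) = inj₁ (≤-antisym c≤ q<c)

-- Colourings of the edges at one index

-- The edges at the cycle edge i = {i, i+1}: A i = {i, eᵢ}, B i = {eᵢ, i+1}, O i = {i, i+1}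
-- and L i = {eᵢ, eᵢ₊₁}. Kinds are Fin 4 so that quantifiers over them are decidable.
Kind : Set
Kind = Fin 4

pattern A = Fin.zero
pattern B = Fin.suc Fin.zero
pattern O = Fin.suc (Fin.suc Fin.zero)
pattern L = Fin.suc (Fin.suc (Fin.suc Fin.zero))

-- shareNext τ τ′ holds when (τ , i) and (τ′ , i+1) share a vertex; conflictNext also
-- records that L i crosses O (i+1).
shareNext : Kind → Kind → Bool
shareNext B A = true
shareNext B O = true
shareNext O A = true
shareNext O O = true
shareNext L A = true
shareNext L B = true
shareNext L L = true
shareNext _ _ = false

conflictNext : Kind → Kind → Bool
conflictNext L O = true
conflictNext τ τ′ = shareNext τ τ′

shareNext⊆conflictNext : ∀ τ τ′ → shareNext τ τ′ ≡ true → conflictNext τ τ′ ≡ true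
shareNext⊆conflictNext L O ()
shareNext⊆conflictNext A _ x = x
shareNext⊆conflictNext B _ x = x
shareNext⊆conflictNext O _ x = x
shareNext⊆conflictNext L A x = x
shareNext⊆conflictNext L B x = x
shareNext⊆conflictNext L L x = x

State : ℕ → Set
State k = Kind → Fin k

state : ∀ {k} → Fin k → Fin k → Fin k → Fin k → State k
state a _ _ _ A = a
state _ b _ _ B = b
state _ _ o _ O = o
state _ _ _ l L = l

module Steps {k : ℕ} (allowed : Kind → Bool) (X : Kind → Kind → Bool) where

  Proper : State k → Set
  Proper s = ∀ τ τ′ → allowed τ ≡ true → allowed τ′ ≡ true → s τ ≡ s τ′ → τ ≡ τ′

  Compatible : State k → State k → Set
  Compatible s t = ∀ τ τ′ → allowed τ ≡ true → allowed τ′ ≡ true → X τ τ′ ≡ true → s τ ≢ t τ′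

  Step : State k → State k → Set
  Step s t = Proper s × Compatible s t

  step? : ∀ s t → Dec (Step s t)
  step? s t = all? (λ τ → all? λ τ′ → allowed τ Bool.≟ true →-dec allowed τ′ Bool.≟ true →-dec
                                      s τ Fin.≟ s τ′ →-dec τ Fin.≟ τ′)
          ×-dec all? (λ τ → all? λ τ′ → allowed τ Bool.≟ true →-dec allowed τ′ Bool.≟ true →-dec
                                        X τ τ′ Bool.≟ true →-dec ¬? (s τ Fin.≟ t τ′))

  infixr 5 _▸_
  _▸_ : ∀ s {t u ℓ} {checked : True (step? s t)} → Walk Step ℓ t u → Walk Step (suc ℓ) s u
  _▸_ s {checked = checked} w = toWitness checked ∷ w

open Steps public using (Proper; Compatible; Step)

O-kind S-kinds L-kind R-kinds Q-kinds T-kinds : Kind → Bool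
O-kind O = true
O-kind _ = false
S-kinds A = true
S-kinds B = true
S-kinds _ = false
L-kind L = true
L-kind _ = false
R-kinds τ = O-kind τ ∨ S-kinds τ
Q-kinds τ = S-kinds τ ∨ L-kind τ
T-kinds τ = O-kind τ ∨ Q-kinds τ

T-kinds-all : ∀ τ → T-kinds τ ≡ true
T-kinds-all A = refl
T-kinds-all B = refl
T-kinds-all O = refl
T-kinds-all L = refl

-- Lengths 3, 4 and 5 generate every n ≥ 3; with five colours there is no closed walk of length 2.
record ShortClosedWalks (k : ℕ) (allowed : Kind → Bool) (X : Kind → Kind → Bool) : Set where
  field
    base  : State k
    walk₃ : Walk (Step allowed X) 3 base base
    walk₄ : Walk (Step allowed X) 4 base base
    walk₅ : Walk (Step allowed X) 5 base base

twoColours : ShortClosedWalks 2 S-kinds shareNext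
twoColours = record
  { base  = s
  ; walk₃ = s ▸ s ▸ s ▸ []
  ; walk₄ = s ▸ s ▸ s ▸ s ▸ []
  ; walk₅ = s ▸ s ▸ s ▸ s ▸ s ▸ []
  }
  where
    open Steps {2} S-kinds shareNext using (_▸_)
    s = state 0F 1F 0F 0F

fourColours : ShortClosedWalks 4 T-kinds shareNext
fourColours = record
  { base  = s₀
  ; walk₃ = s₀ ▸ s₁ ▸ s₂ ▸ []
  ; walk₄ = s₀ ▸ s₃ ▸ s₀ ▸ s₃ ▸ []
  ; walk₅ = s₀ ▸ s₃ ▸ s₀ ▸ s₁ ▸ s₂ ▸ []
  }
  where
    open Steps {4} T-kinds shareNext using (_▸_)
    s₀ = state 0F 1F 2F 3F
    s₁ = state 0F 2F 3F 1F
    s₂ = state 0F 3F 1F 2F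
    s₃ = state 0F 1F 3F 2F

fiveColours : ShortClosedWalks 5 T-kinds conflictNext
fiveColours = record
  { base  = s₀
  ; walk₃ = s₀ ▸ s₁ ▸ s₂ ▸ []
  ; walk₄ = s₀ ▸ t₁ ▸ t₂ ▸ t₃ ▸ []
  ; walk₅ = s₀ ▸ s₁ ▸ u₂ ▸ u₃ ▸ u₄ ▸ []
  }
  where
    open Steps {5} T-kinds conflictNext using (_▸_)
    s₀ = state 0F 1F 2F 3F
    s₁ = state 0F 1F 4F 2F
    s₂ = state 0F 1F 3F 4F
    t₁ = state 0F 2F 4F 1F
    t₂ = state 0F 4F 3F 2F
    t₃ = state 0F 3F 1F 4F
    u₂ = state 3F 4F 0F 1F
    u₃ = state 2F 4F 3F 0F
    u₄ = state 2F 3F 1F 4F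

-- The cycle C n and its derived graphs

module Construction (m : ℕ) where

  n : ℕ
  n = 3 + m

  next : ℕ → ℕ
  next i = suc i % n

  next<n : ∀ i → next i < n
  next<n i = m%n<n (suc i) n

  next-nonlast : ∀ {i} → suc i < n → next i ≡ suc i
  next-nonlast = m<n⇒m%n≡m

  next-last : ∀ {i} → suc i ≡ n → next i ≡ 0
  next-last eq = trans (cong (_% n) eq) (n%n≡0 n)

  nonlast-or-last : ∀ {i} → i < n → suc i < n ⊎ suc i ≡ n
  nonlast-or-last = m≤n⇒m<n∨m≡n

  next-injective : ∀ {i j} → i < n → j < n → next i ≡ next j → i ≡ j
  next-injective {i} {j} i<n j<n eq with nonlast-or-last i<n | nonlast-or-last j<n
  ... | inj₁ i′ | inj₁ j′ = suc-injective (trans (sym (next-nonlast i′)) (trans eq (next-nonlast j′)))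
  ... | inj₁ i′ | inj₂ j′ with () ← trans (sym (next-nonlast i′)) (trans eq (next-last j′))
  ... | inj₂ i′ | inj₁ j′ with () ← trans (sym (next-last i′)) (trans eq (next-nonlast j′))
  ... | inj₂ i′ | inj₂ j′ = suc-injective (trans i′ (sym j′))

  next≢id : ∀ {i} → i < n → next i ≢ i
  next≢id {i} i<n eq with nonlast-or-last i<n
  ... | inj₁ nonlast = 1+n≢n (trans (sym (next-nonlast nonlast)) eq)
  ... | inj₂ last with refl ← trans (sym eq) (next-last last) with () ← last

  0<n : 0 < n
  0<n = z<s

  2≢n : 2 ≢ n
  2≢n ()

  next²≢id : ∀ {i} → i < n → next (next i) ≢ i
  next²≢id {i} i<n with nonlast-or-last i<n
  ... | inj₂ last rewrite next-last last | next-nonlast {0} (s≤s (s≤s z≤n)) = λ { refl → 2≢n last }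
  ... | inj₁ nonlast rewrite next-nonlast nonlast with nonlast-or-last nonlast
  ...   | inj₁ nonlast′ rewrite next-nonlast nonlast′ = ≢-sym (<⇒≢ (<-trans (n<1+n i) (n<1+n (suc i))))
  ...   | inj₂ last rewrite next-last last = λ { refl → 2≢n last }

  prev : ℕ → ℕ
  prev zero    = suc (suc m)
  prev (suc i) = i

  prev<n : ∀ {i} → i < n → prev i < n
  prev<n {zero}  _   = ≤-refl
  prev<n {suc i} i<n = <-trans (n<1+n i) i<n

  next-prev : ∀ {i} → i < n → next (prev i) ≡ i
  next-prev {zero}  _   = next-last refl
  next-prev {suc i} i<n = next-nonlast i<n

  prev≢id : ∀ {i} → i < n → prev i ≢ i
  prev≢id i<n eq = next≢id (prev<n i<n) (trans (next-prev i<n) (sym eq))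

  -- Vertex codes as in Defs: the old vertex c is c and eₖ is n + k. L i lists its smaller
  -- endpoint first, as lineEdges does.
  endpoints : Kind → ℕ → ℕ × ℕ
  endpoints A i = i , n + i
  endpoints B i = n + i , next i
  endpoints O i = i , next i
  endpoints L i = n + (i ⊓ next i) , n + (i ⊔ next i)

  Touches : ℕ → Kind → ℕ → Set
  Touches c τ i = c ≡ proj₁ (endpoints τ i) ⊎ c ≡ proj₂ (endpoints τ i)

  data TouchesOld (c : ℕ) : Kind → ℕ → Set where
    ownA  : TouchesOld c A c
    ownO  : TouchesOld c O c
    prevB : ∀ {j} → next j ≡ c → TouchesOld c B j
    prevO : ∀ {j} → next j ≡ c → TouchesOld c O j

  data TouchesNew (k : ℕ) : Kind → ℕ → Set where
    ownA  : TouchesNew k A k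
    ownB  : TouchesNew k B k
    ownL  : TouchesNew k L k
    prevL : ∀ {j} → next j ≡ k → TouchesNew k L j

  n+≢old : ∀ {c k} → c < n → c ≢ n + k
  n+≢old {c} {k} c<n refl = <⇒≱ c<n (m≤m+n n k)

  touchesOld : ∀ {c τ j} → c < n → Touches c τ j → TouchesOld c τ j
  touchesOld {τ = A} c<n (inj₁ refl) = ownA
  touchesOld {τ = A} c<n (inj₂ eq)   = ⊥-elim (n+≢old c<n eq)
  touchesOld {τ = B} c<n (inj₁ eq)   = ⊥-elim (n+≢old c<n eq)
  touchesOld {τ = B} c<n (inj₂ eq)   = prevB (sym eq)
  touchesOld {τ = O} c<n (inj₁ refl) = ownO
  touchesOld {τ = O} c<n (inj₂ eq)   = prevO (sym eq)
  touchesOld {τ = L} c<n (inj₁ eq)   = ⊥-elim (n+≢old c<n eq)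
  touchesOld {τ = L} c<n (inj₂ eq)   = ⊥-elim (n+≢old c<n eq)

  touchesL : ∀ {k j x} → k ≡ x → x ≡ j ⊎ x ≡ next j → TouchesNew k L j
  touchesL refl (inj₁ refl)   = ownL
  touchesL refl (inj₂ x≡next) = prevL (sym x≡next)

  touchesNew : ∀ {k τ j} → j < n → Touches (n + k) τ j → TouchesNew k τ j
  touchesNew {τ = A} j<n (inj₁ eq) = ⊥-elim (n+≢old j<n (sym eq))
  touchesNew {τ = A} j<n (inj₂ eq) with refl ← +-cancelˡ-≡ n _ _ eq = ownA
  touchesNew {τ = B} j<n (inj₁ eq) with refl ← +-cancelˡ-≡ n _ _ eq = ownB
  touchesNew {τ = B} {j} j<n (inj₂ eq) = ⊥-elim (n+≢old (next<n j) (sym eq))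
  touchesNew {τ = O} j<n (inj₁ eq) = ⊥-elim (n+≢old j<n (sym eq))
  touchesNew {τ = O} {j} j<n (inj₂ eq) = ⊥-elim (n+≢old (next<n j) (sym eq))
  touchesNew {τ = L} {j} j<n (inj₁ eq) = touchesL (+-cancelˡ-≡ n _ _ eq) (⊓-sel j (next j))
  touchesNew {τ = L} {j} j<n (inj₂ eq) = touchesL (+-cancelˡ-≡ n _ _ eq) (⊔-sel j (next j))

  data Clash (X : Kind → Kind → Bool) : Kind → ℕ → Kind → ℕ → Set where
    same-index : ∀ {τ τ′ i}   → τ ≢ τ′ → Clash X τ i τ′ i
    next-index : ∀ {τ τ′ i j} → j ≡ next i → X τ τ′ ≡ true → Clash X τ i τ′ j
    prev-index : ∀ {τ τ′ i j} → i ≡ next j → X τ′ τ ≡ true → Clash X τ i τ′ j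

  Clash-mono : ∀ {X Y} → (∀ τ τ′ → X τ τ′ ≡ true → Y τ τ′ ≡ true) →
               ∀ {τ i τ′ j} → Clash X τ i τ′ j → Clash Y τ i τ′ j
  Clash-mono X⊆Y (same-index τ≢τ′)  = same-index τ≢τ′
  Clash-mono X⊆Y (next-index j≡ x)  = next-index j≡ (X⊆Y _ _ x)
  Clash-mono X⊆Y (prev-index i≡ x)  = prev-index i≡ (X⊆Y _ _ x)

  oldClash : ∀ {c τ i τ′ j} → i < n → j < n → (τ , i) ≢ (τ′ , j) →
             TouchesOld c τ i → TouchesOld c τ′ j → Clash shareNext τ i τ′ j
  oldClash _ _ ne ownA      ownA      = ⊥-elim (ne refl)
  oldClash _ _ _  ownA      ownO      = same-index λ ()
  oldClash _ _ _  ownA      (prevB p) = prev-index (sym p) refl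
  oldClash _ _ _  ownA      (prevO p) = prev-index (sym p) refl
  oldClash _ _ _  ownO      ownA      = same-index λ ()
  oldClash _ _ ne ownO      ownO      = ⊥-elim (ne refl)
  oldClash _ _ _  ownO      (prevB p) = prev-index (sym p) refl
  oldClash _ _ _  ownO      (prevO p) = prev-index (sym p) refl
  oldClash _ _ _  (prevB p) ownA      = next-index (sym p) refl
  oldClash _ _ _  (prevB p) ownO      = next-index (sym p) refl
  oldClash i<n j<n ne (prevB p) (prevB q) with refl ← next-injective i<n j<n (trans p (sym q)) = ⊥-elim (ne refl)
  oldClash i<n j<n _  (prevB p) (prevO q) with refl ← next-injective i<n j<n (trans p (sym q)) = same-index λ ()
  oldClash _ _ _  (prevO p) ownA      = next-index (sym p) refl
  oldClash _ _ _  (prevO p) ownO      = next-index (sym p) refl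
  oldClash i<n j<n _  (prevO p) (prevB q) with refl ← next-injective i<n j<n (trans p (sym q)) = same-index λ ()
  oldClash i<n j<n ne (prevO p) (prevO q) with refl ← next-injective i<n j<n (trans p (sym q)) = ⊥-elim (ne refl)

  newClash : ∀ {k τ i τ′ j} → i < n → j < n → (τ , i) ≢ (τ′ , j) →
             TouchesNew k τ i → TouchesNew k τ′ j → Clash shareNext τ i τ′ j
  newClash _ _ ne ownA      ownA      = ⊥-elim (ne refl)
  newClash _ _ _  ownA      ownB      = same-index λ ()
  newClash _ _ _  ownA      ownL      = same-index λ ()
  newClash _ _ _  ownA      (prevL p) = prev-index (sym p) refl
  newClash _ _ _  ownB      ownA      = same-index λ ()
  newClash _ _ ne ownB      ownB      = ⊥-elim (ne refl)
  newClash _ _ _  ownB      ownL      = same-index λ ()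
  newClash _ _ _  ownB      (prevL p) = prev-index (sym p) refl
  newClash _ _ _  ownL      ownA      = same-index λ ()
  newClash _ _ _  ownL      ownB      = same-index λ ()
  newClash _ _ ne ownL      ownL      = ⊥-elim (ne refl)
  newClash _ _ _  ownL      (prevL p) = prev-index (sym p) refl
  newClash _ _ _  (prevL p) ownA      = next-index (sym p) refl
  newClash _ _ _  (prevL p) ownB      = next-index (sym p) refl
  newClash _ _ _  (prevL p) ownL      = next-index (sym p) refl
  newClash i<n j<n ne (prevL p) (prevL q) with refl ← next-injective i<n j<n (trans p (sym q)) = ⊥-elim (ne refl)

  data Vertex : ℕ → Set where
    old : ∀ {c} → c < n → Vertex c
    new : ∀ k → Vertex (n + k)

  vertex : ∀ c → Vertex c
  vertex c with c <? n
  ... | yes c<n = old c<n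
  ... | no c≮n  = subst Vertex (m+[n∸m]≡n (≮⇒≥ c≮n)) (new (c ∸ n))

  shared-endpoint⇒Clash : ∀ {c τ i τ′ j} → i < n → j < n → (τ , i) ≢ (τ′ , j) →
                          Touches c τ i → Touches c τ′ j → Clash shareNext τ i τ′ j
  shared-endpoint⇒Clash {c} i<n j<n ne t t′ with vertex c
  ... | old c<n = oldClash i<n j<n ne (touchesOld c<n t) (touchesOld c<n t′)
  ... | new _   = newClash i<n j<n ne (touchesNew i<n t) (touchesNew j<n t′)

  position : ℕ → ℕ
  position c = if c <ᵇ n then 2 * c else suc (2 * (c ∸ n))

  position-old : ∀ {c} → c < n → position c ≡ 2 * c
  position-old {c} c<n with c <ᵇ n | <⇒<ᵇ c<n
  ... | true | _ = refl

  position-new : ∀ k → position (n + k) ≡ suc (2 * k)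
  position-new k with n + k <ᵇ n in eq
  ... | true  = ⊥-elim (<⇒≱ (<ᵇ⇒< (n + k) n (subst IsTrue (sym eq) _)) (m≤m+n n k))
  ... | false = cong (λ x → suc (2 * x)) (m+n∸m≡n n k)

  position-injective : ∀ {c c′} → position c ≡ position c′ → c ≡ c′
  position-injective {c} {c′} eq with vertex c | vertex c′
  ... | old c<n | old c′<n = *-cancelˡ-≡ c c′ 2 (trans (sym (position-old c<n)) (trans eq (position-old c′<n)))
  ... | old c<n | new k′   = ⊥-elim (even≢odd c k′ (trans (sym (position-old c<n)) (trans eq (position-new k′))))
  ... | new k   | old c′<n = ⊥-elim (even≢odd c′ k (trans (sym (position-old c′<n)) (trans (sym eq) (position-new k))))
  ... | new k   | new k′   =
    cong (n +_) (*-cancelˡ-≡ k k′ 2 (suc-injective (trans (sym (position-new k)) (trans eq (position-new k′)))))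

  position<2n : ∀ {c} → c < 2 * n → position c < 2 * n
  position<2n {c} c<2n with vertex c
  ... | old c<n rewrite position-old c<n = *-monoʳ-< 2 c<n
  ... | new k rewrite position-new k = subst (_≤ 2 * n) (*-suc 2 k) (*-monoʳ-≤ 2 (+-cancelˡ-< n _ _ n+k<n+n))
    where
      n+k<n+n : n + k < n + n
      n+k<n+n = subst (n + k <_) (cong (n +_) (+-identityʳ n)) c<2n

  old<2n : ∀ {c} → c < n → c < 2 * n
  old<2n c<n = <-≤-trans c<n (m≤m+n n (n + 0))

  new<2n : ∀ {k} → k < n → n + k < 2 * n
  new<2n {k} k<n = +-monoʳ-< n (subst (k <_) (sym (+-identityʳ n)) k<n)

  endpoints<2n : ∀ τ {i} → i < n → proj₁ (endpoints τ i) < 2 * n × proj₂ (endpoints τ i) < 2 * n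
  endpoints<2n A {i} i<n = old<2n i<n , new<2n i<n
  endpoints<2n B {i} i<n = new<2n i<n , old<2n (next<n i)
  endpoints<2n O {i} i<n = old<2n i<n , old<2n (next<n i)
  endpoints<2n L {i} i<n = new<2n (≤-<-trans (m⊓n≤m i (next i)) i<n) , new<2n (⊔-lub i<n (next<n i))

  spine : Kind → ℕ → ℕ × ℕ
  spine τ i = position (proj₁ (endpoints τ i)) , position (proj₂ (endpoints τ i))

  position-next : ∀ {i} → suc i < n → position (next i) ≡ suc (suc (2 * i))
  position-next {i} nonlast = trans (cong position (next-nonlast nonlast)) (trans (position-old nonlast) (*-suc 2 i))

  position-last-bound : ∀ {i c} → suc i ≡ n → c < 2 * n → position c ≤ suc (2 * i)
  position-last-bound {i} {c} last c<2n =
    ≤-pred (subst (position c <_) (trans (cong (2 *_) (sym last)) (*-suc 2 i)) (position<2n c<2n))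

  spine-A : ∀ {i} → i < n → spine A i ≡ (2 * i , suc (2 * i))
  spine-A {i} i<n rewrite position-old i<n | position-new i = refl

  spine-B-nonlast : ∀ {i} → suc i < n → spine B i ≡ (suc (2 * i) , suc (suc (2 * i)))
  spine-B-nonlast {i} nonlast rewrite position-new i | position-next nonlast = refl

  spine-B-last : ∀ {i} → suc i ≡ n → spine B i ≡ (suc (2 * i) , 0)
  spine-B-last {i} last rewrite position-new i | next-last last = refl

  spine-O-nonlast : ∀ {i} → suc i < n → spine O i ≡ (2 * i , suc (suc (2 * i)))
  spine-O-nonlast {i} nonlast rewrite position-old (<-trans (n<1+n i) nonlast) | position-next nonlast = refl

  spine-O-last : ∀ {i} → suc i ≡ n → spine O i ≡ (2 * i , 0)
  spine-O-last {i} last rewrite position-old (subst (i <_) last (n<1+n i)) | next-last last = refl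

  spine-L-nonlast : ∀ {i} → suc i < n → spine L i ≡ (suc (2 * i) , suc (suc (suc (2 * i))))
  spine-L-nonlast {i} nonlast
    rewrite next-nonlast nonlast | m≤n⇒m⊓n≡m (n≤1+n i) | m≤n⇒m⊔n≡n (n≤1+n i)
          | position-new i | position-new (suc i) | *-suc 2 i = refl

  spine-L-last : ∀ {i} → suc i ≡ n → spine L i ≡ (1 , suc (2 * i))
  spine-L-last {i} last rewrite next-last last | ⊓-zeroʳ i | ⊔-identityʳ i | position-new 0 | position-new i = refl

  spine-touching : ∀ {c τ j} →
                   position (proj₁ (endpoints τ j)) ≡ position c ⊎ position (proj₂ (endpoints τ j)) ≡ position c →
                   Touches c τ j
  spine-touching (inj₁ eq) = inj₁ (sym (position-injective eq))
  spine-touching (inj₂ eq) = inj₂ (sym (position-injective eq))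

  ¬Crosses-A : ∀ {j} e → j < n → ¬ Crosses e (spine A j)
  ¬Crosses-A {j} e j<n = ¬Crosses-unit-right e (2 * j) ∘ subst (Crosses e) (spine-A j<n)

  ¬Crosses-B : ∀ {j} e → j < n → ¬ Crosses e (spine B j)
  ¬Crosses-B {j} e j<n with nonlast-or-last j<n
  ... | inj₁ nonlast = ¬Crosses-unit-right e (suc (2 * j)) ∘ subst (Crosses e) (spine-B-nonlast nonlast)
  ... | inj₂ last    = ¬Crosses-zero-right e (suc (2 * j)) ∘ subst (Crosses e) (spine-B-last last)

  data CrossingPair : Kind → ℕ → Kind → ℕ → Set where
    O-L-same : ∀ {i}   → CrossingPair O i L i
    O-L-prev : ∀ {i j} → next j ≡ i → CrossingPair O i L j
    L-O-same : ∀ {i}   → CrossingPair L i O i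
    L-O-next : ∀ {i}   → CrossingPair L i O (next i)

  crossing-at-new : ∀ {i τ′ j} → j < n → Crosses (spine O i) (spine τ′ j) → Touches (n + i) τ′ j →
                    CrossingPair O i τ′ j
  crossing-at-new {i} {τ′} {j} j<n crosses touches with touchesNew {i} {τ′} {j} j<n touches
  ... | ownA    = ⊥-elim (¬Crosses-A (spine O i) j<n crosses)
  ... | ownB    = ⊥-elim (¬Crosses-B (spine O i) j<n crosses)
  ... | ownL    = O-L-same
  ... | prevL p = O-L-prev p

  crossing-at-old : ∀ {i τ′ j} → i < n → j < n → Crosses (spine L i) (spine τ′ j) → Touches (next i) τ′ j →
                    CrossingPair L i τ′ j
  crossing-at-old {i} {τ′} {j} i<n j<n crosses touches with touchesOld {next i} {τ′} {j} (next<n i) touches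
  ... | ownA    = ⊥-elim (¬Crosses-A (spine L i) j<n crosses)
  ... | prevB _ = ⊥-elim (¬Crosses-B (spine L i) j<n crosses)
  ... | ownO    = L-O-next
  ... | prevO p with refl ← next-injective j<n i<n p = L-O-same

  -- A and B join spine neighbours (or the two ends of the spine); cyclically, O i jumps over eᵢ
  -- and L i over next i, so an edge crossing them ends at that vertex.
  crossing⇒CrossingPair : ∀ τ τ′ {i j} → i < n → j < n → Crosses (spine τ i) (spine τ′ j) →
                          CrossingPair τ i τ′ j
  crossing⇒CrossingPair τ τ′ {i} {j} i<n j<n = by-kind τ (nonlast-or-last i<n)
    where
      from : ∀ τ {s} → spine τ i ≡ s → Crosses (spine τ i) (spine τ′ j) → Crosses s (spine τ′ j)
      from _ eq = subst (λ s → Crosses s (spine τ′ j)) eq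

      bound₁ : suc i ≡ n → proj₁ (spine τ′ j) ≤ suc (2 * i)
      bound₂ : suc i ≡ n → proj₂ (spine τ′ j) ≤ suc (2 * i)
      bound₁ last = position-last-bound last (proj₁ (endpoints<2n τ′ j<n))
      bound₂ last = position-last-bound last (proj₂ (endpoints<2n τ′ j<n))

      hits : ∀ {c p} → position c ≡ p → proj₁ (spine τ′ j) ≡ p ⊎ proj₂ (spine τ′ j) ≡ p → Touches c τ′ j
      hits refl hit = spine-touching {τ = τ′} {j = j} hit

      by-kind : ∀ τ → suc i < n ⊎ suc i ≡ n → Crosses (spine τ i) (spine τ′ j) → CrossingPair τ i τ′ j
      by-kind A _ c = ⊥-elim (¬Crosses-unit-left (2 * i) _ (from A (spine-A i<n) c))
      by-kind B (inj₁ nonlast) c = ⊥-elim (¬Crosses-unit-left (suc (2 * i)) _ (from B (spine-B-nonlast nonlast) c))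
      by-kind B (inj₂ last) c =
        ⊥-elim (¬Crosses-from-max ≤-refl z≤n (bound₁ last) (bound₂ last) (inj₁ refl) (from B (spine-B-last last) c))
      by-kind O (inj₁ nonlast) c =
        crossing-at-new j<n c (hits (position-new i) (Crosses-span-two (2 * i) _ _ (from O (spine-O-nonlast nonlast) c)))
      by-kind O (inj₂ last) c =
        crossing-at-new j<n c (hits (position-new i)
          (Crosses-wrap (2 * i) _ _ (bound₁ last) (bound₂ last) (from O (spine-O-last last) c)))
      by-kind L (inj₁ nonlast) c =
        crossing-at-old i<n j<n c (hits (position-next nonlast)
          (Crosses-span-two (suc (2 * i)) _ _ (from L (spine-L-nonlast nonlast) c)))
      by-kind L (inj₂ last) c =
        ⊥-elim (¬Crosses-from-max (s≤s z≤n) ≤-refl (bound₁ last) (bound₂ last) (inj₂ refl)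
                                  (from L (spine-L-last last) c))

  CrossingPair⇒Clash : ∀ {τ i τ′ j} → CrossingPair τ i τ′ j → Clash conflictNext τ i τ′ j
  CrossingPair⇒Clash O-L-same       = same-index λ ()
  CrossingPair⇒Clash (O-L-prev p)   = prev-index (sym p) refl
  CrossingPair⇒Clash L-O-same       = same-index λ ()
  CrossingPair⇒Clash L-O-next       = next-index refl refl

  CrossingPair-kinds : ∀ {τ i τ′ j} → CrossingPair τ i τ′ j → τ ≡ O × τ′ ≡ L ⊎ τ ≡ L × τ′ ≡ O
  CrossingPair-kinds O-L-same     = inj₁ (refl , refl)
  CrossingPair-kinds (O-L-prev _) = inj₁ (refl , refl)
  CrossingPair-kinds L-O-same     = inj₂ (refl , refl)
  CrossingPair-kinds L-O-next     = inj₂ (refl , refl)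

  record Colouring (k : ℕ) (allowed : Kind → Bool) (X : Kind → Kind → Bool) : Set where
    field
      colour : ℕ → State k
      step   : ∀ i → i < n → Step allowed X (colour i) (colour (next i))

    colour-distinct : ∀ {τ i τ′ j} → allowed τ ≡ true → allowed τ′ ≡ true → i < n → j < n →
                      Clash X τ i τ′ j → colour i τ ≢ colour j τ′
    colour-distinct {τ} {i} {τ′} okτ okτ′ i<n _ (same-index τ≢τ′) =
      τ≢τ′ ∘ proj₁ (step i i<n) τ τ′ okτ okτ′
    colour-distinct {τ} {i} {τ′} okτ okτ′ i<n _ (next-index refl x) =
      proj₂ (step i i<n) τ τ′ okτ okτ′ x
    colour-distinct {τ} {i} {τ′} {j} okτ okτ′ _ j<n (prev-index refl x) =
      proj₂ (step j j<n) τ′ τ okτ′ okτ x ∘ sym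

    restrict : ∀ {a} → (∀ τ → a τ ≡ true → allowed τ ≡ true) → Colouring k a X
    restrict a⊆allowed = record
      { colour = colour
      ; step   = λ i i<n → (λ τ τ′ aτ aτ′ → proj₁ (step i i<n) τ τ′ (a⊆allowed τ aτ) (a⊆allowed τ′ aτ′))
                         , (λ τ τ′ aτ aτ′ → proj₂ (step i i<n) τ τ′ (a⊆allowed τ aτ) (a⊆allowed τ′ aτ′))
      }

  colouring : ∀ {k allowed X} → ShortClosedWalks k allowed X → Colouring k allowed X
  colouring {k} {allowed} {X} walks = record { colour = vertexAt _ walk ; step = step }
    where
      open ShortClosedWalks walks
      walk : Walk (Step allowed X) n base base
      walk = closedWalk-3+ _ walk₃ walk₄ walk₅ m
      step : ∀ i → i < n → Step allowed X (vertexAt _ walk i) (vertexAt _ walk (next i))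
      step i i<n with nonlast-or-last i<n
      ... | inj₁ nonlast rewrite next-nonlast nonlast = vertexAt-step _ walk i<n
      ... | inj₂ last rewrite next-last last =
        subst (Step allowed X (vertexAt _ walk i)) (trans (cong (vertexAt _ walk) last) (vertexAt-end _ walk))
              (vertexAt-step _ walk i<n)

  L-endpoints-index : ∀ {i j} → endpoints L i ≡ endpoints L j → i ≡ j ⊎ i ≡ next j
  L-endpoints-index {i} {j} eq with ≤-total i (next i)
  ... | inj₁ i≤ = Sum.map (trans i≡min) (trans i≡min) (⊓-sel j (next j))
    where i≡min = trans (sym (m≤n⇒m⊓n≡m i≤)) (+-cancelˡ-≡ n _ _ (cong proj₁ eq))
  ... | inj₂ ≥i = Sum.map (trans i≡max) (trans i≡max) (⊔-sel j (next j))
    where i≡max = trans (sym (m≥n⇒m⊔n≡m ≥i)) (+-cancelˡ-≡ n _ _ (cong proj₂ eq))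

  endpoints-injective : ∀ {τ τ′ i j} → i < n → j < n → endpoints τ i ≡ endpoints τ′ j → (τ , i) ≡ (τ′ , j)
  endpoints-injective {A} {A} _ _ eq = cong (A ,_) (cong proj₁ eq)
  endpoints-injective {B} {B} _ _ eq = cong (B ,_) (+-cancelˡ-≡ n _ _ (cong proj₁ eq))
  endpoints-injective {O} {O} _ _ eq = cong (O ,_) (cong proj₁ eq)
  endpoints-injective {L} {L} i<n j<n eq with L-endpoints-index eq | L-endpoints-index (sym eq)
  ... | inj₁ i≡j | _        = cong (L ,_) i≡j
  ... | _        | inj₁ j≡i = cong (L ,_) (sym j≡i)
  ... | inj₂ i≡  | inj₂ j≡  = ⊥-elim (next²≢id i<n (trans (cong next (sym j≡)) (sym i≡)))
  endpoints-injective {A} {B} i<n _ eq = ⊥-elim (n+≢old i<n (cong proj₁ eq))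
  endpoints-injective {A} {O} {j = j} _ _ eq = ⊥-elim (n+≢old (next<n j) (sym (cong proj₂ eq)))
  endpoints-injective {A} {L} i<n _ eq = ⊥-elim (n+≢old i<n (cong proj₁ eq))
  endpoints-injective {B} {A} _ j<n eq = ⊥-elim (n+≢old j<n (sym (cong proj₁ eq)))
  endpoints-injective {B} {O} _ j<n eq = ⊥-elim (n+≢old j<n (sym (cong proj₁ eq)))
  endpoints-injective {B} {L} {i} _ _ eq = ⊥-elim (n+≢old (next<n i) (cong proj₂ eq))
  endpoints-injective {O} {A} {i} _ _ eq = ⊥-elim (n+≢old (next<n i) (cong proj₂ eq))
  endpoints-injective {O} {B} i<n _ eq = ⊥-elim (n+≢old i<n (cong proj₁ eq))
  endpoints-injective {O} {L} i<n _ eq = ⊥-elim (n+≢old i<n (cong proj₁ eq))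
  endpoints-injective {L} {A} _ j<n eq = ⊥-elim (n+≢old j<n (sym (cong proj₁ eq)))
  endpoints-injective {L} {B} {j = j} _ _ eq = ⊥-elim (n+≢old (next<n j) (sym (cong proj₂ eq)))
  endpoints-injective {L} {O} _ j<n eq = ⊥-elim (n+≢old j<n (sym (cong proj₁ eq)))

  endpoints-distinct : ∀ τ {i} → i < n → proj₁ (endpoints τ i) ≢ proj₂ (endpoints τ i)
  endpoints-distinct A i<n = n+≢old i<n
  endpoints-distinct B {i} _ = ≢-sym (n+≢old (next<n i))
  endpoints-distinct O i<n = ≢-sym (next≢id i<n)
  endpoints-distinct L {i} i<n eq = next≢id i<n (sym (⊓≡⊔⇒≡ (+-cancelˡ-≡ n _ _ eq)))

  G₀ : Graph
  G₀ = C n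

  E : ℕ
  E = nE G₀

  E≡n : E ≡ n
  E≡n = trans (length-map _ (allFin n)) (length-tabulate {n = n} id)

  N : ℕ
  N = n + E

  N≡2n : N ≡ 2 * n
  N≡2n = cong (n +_) (trans E≡n (sym (+-identityʳ n)))

  code : Fin N × Fin N → ℕ × ℕ
  code (a , b) = toℕ a , toℕ b

  code-injective : ∀ {x y} → code x ≡ code y → x ≡ y
  code-injective {_ , _} {_ , _} eq = cong₂ _,_ (toℕ-injective (cong proj₁ eq)) (toℕ-injective (cong proj₂ eq))

  edgeAt : ∀ {i} → i < n → Fin E
  edgeAt {i} i<n = Fin.fromℕ< (subst (i <_) (sym E≡n) i<n)

  toℕ-edgeAt : ∀ {i} (i<n : i < n) → toℕ (edgeAt i<n) ≡ i
  toℕ-edgeAt {i} i<n = toℕ-fromℕ< (subst (i <_) (sym E≡n) i<n)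

  toℕ-edge<n : ∀ (e : Fin E) → toℕ e < n
  toℕ-edge<n e = subst (toℕ e <_) E≡n (toℕ<n e)

  cycle-ends : ∀ e → toℕ (proj₁ (ends G₀ e)) ≡ toℕ e × toℕ (proj₂ (ends G₀ e)) ≡ next (toℕ e)
  cycle-ends e with lookup-map-tabulate {n = n} id (λ i → i , (suc (toℕ i) mod n)) e
  ... | i , i≡e , eq = subst (λ (a , b) → toℕ a ≡ toℕ e × toℕ b ≡ next (toℕ e)) (sym eq)
                             (i≡e , trans (toℕ-fromℕ< _) (cong next i≡e))

  oldV : Fin n → Fin N
  oldV u = u ↑ˡ E

  newV : Fin E → Fin N
  newV e = n ↑ʳ e

  Classified : (Kind → Bool) → Fin N × Fin N → Set
  Classified allowed x = Σ (Kind × ℕ) λ (τ , i) → i < n × allowed τ ≡ true × code x ≡ endpoints τ i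

  Classified-weaken : ∀ {a b x} → (∀ τ → a τ ≡ true → b τ ≡ true) → Classified a x → Classified b x
  Classified-weaken a⊆b ((τ , i) , i<n , ok , eq) = (τ , i) , i<n , a⊆b τ ok , eq

  original-classified : ∀ {x} → x ∈ oldEdges G₀ → Classified O-kind x
  original-classified x∈ with ∈-map⁻ _ x∈
  ... | _ , p∈ , refl with ∈-map⁻ _ p∈
  ...   | u , _ , refl = (O , toℕ u) , toℕ<n u , refl , cong₂ _,_ (toℕ-↑ˡ u E) (trans (toℕ-↑ˡ _ E) (toℕ-fromℕ< _))

  halves : Fin E → List (Fin N × Fin N)
  halves e = (oldV (proj₁ (ends G₀ e)) , newV e) ∷ (newV e , oldV (proj₂ (ends G₀ e))) ∷ []

  subdivision-classified : ∀ {x} → x ∈ subdivEdges G₀ → Classified S-kinds x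
  subdivision-classified x∈ with Any.satisfied (∈-concatMap⁻ halves {xs = allFin E} x∈)
  ... | e , here refl =
    (A , toℕ e) , toℕ-edge<n e , refl , cong₂ _,_ (trans (toℕ-↑ˡ _ E) (proj₁ (cycle-ends e))) (toℕ-↑ʳ n e)
  ... | e , there (here refl) =
    (B , toℕ e) , toℕ-edge<n e , refl , cong₂ _,_ (toℕ-↑ʳ n e) (trans (toℕ-↑ˡ _ E) (proj₂ (cycle-ends e)))

  adjacentᵇ : Fin E × Fin E → Bool
  adjacentᵇ (e , f) = (toℕ e <ᵇ toℕ f) ∧ shareᵇ G₀ (ends G₀ e) (ends G₀ f)

  adjacent-pair : ∀ {e f} → IsTrue (adjacentᵇ (e , f)) →
                  toℕ e < toℕ f × (next (toℕ e) ≡ toℕ f ⊎ next (toℕ f) ≡ toℕ e)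
  adjacent-pair {e} {f} t with Equivalence.to Bool.T-∧ t
  ... | lt , shared = e<f , by-shared-end (shareᵇ⇒ShareEnd G₀ shared)
    where
      e<f = <ᵇ⇒< (toℕ e) (toℕ f) lt
      by-shared-end : ShareEnd (ends G₀ e) (ends G₀ f) → next (toℕ e) ≡ toℕ f ⊎ next (toℕ f) ≡ toℕ e
      by-shared-end (inj₁ a≡c) =
        ⊥-elim (<⇒≢ e<f (trans (sym (proj₁ (cycle-ends e))) (trans (cong toℕ a≡c) (proj₁ (cycle-ends f)))))
      by-shared-end (inj₂ (inj₁ a≡d)) =
        inj₂ (trans (sym (proj₂ (cycle-ends f))) (trans (cong toℕ (sym a≡d)) (proj₁ (cycle-ends e))))
      by-shared-end (inj₂ (inj₂ (inj₁ b≡c))) =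
        inj₁ (trans (sym (proj₂ (cycle-ends e))) (trans (cong toℕ b≡c) (proj₁ (cycle-ends f))))
      by-shared-end (inj₂ (inj₂ (inj₂ b≡d))) =
        ⊥-elim (<⇒≢ e<f (next-injective (toℕ-edge<n e) (toℕ-edge<n f)
          (trans (sym (proj₂ (cycle-ends e))) (trans (cong toℕ b≡d) (proj₂ (cycle-ends f))))))

  L-endpoints-adjacent : ∀ {i j} → i < j → j < n → next i ≡ j ⊎ next j ≡ i →
                         ∃[ l ] l < n × endpoints L l ≡ (n + i , n + j)
  L-endpoints-adjacent {i} {j} i<j j<n (inj₁ refl) =
    i , <-trans i<j j<n , cong₂ (λ a b → n + a , n + b) (m≤n⇒m⊓n≡m (<⇒≤ i<j)) (m≤n⇒m⊔n≡n (<⇒≤ i<j))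
  L-endpoints-adjacent {i} {j} i<j j<n (inj₂ refl) =
    j , j<n , cong₂ (λ a b → n + a , n + b) (trans (⊓-comm j (next j)) (m≤n⇒m⊓n≡m (<⇒≤ i<j)))
                                             (trans (⊔-comm j (next j)) (m≤n⇒m⊔n≡n (<⇒≤ i<j)))

  line-classified : ∀ {x} → x ∈ lineEdges G₀ → Classified L-kind x
  line-classified x∈ with ∈-map⁻ _ x∈
  ... | (e , f) , ef∈ , refl with adjacent-pair (proj₂ (∈-filter⁻ (T? ∘ adjacentᵇ) {xs = allFin E ×ˡ allFin E} ef∈))
  ...   | e<f , adjacent with L-endpoints-adjacent e<f (toℕ-edge<n f) adjacent
  ...     | l , l<n , eq = (L , l) , l<n , refl , trans (cong₂ _,_ (toℕ-↑ʳ n e) (toℕ-↑ʳ n f)) (sym eq)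

  Realised : List (Fin N × Fin N) → Kind → ℕ → Set
  Realised xs τ i = ∃[ x ] x ∈ xs × code x ≡ endpoints τ i

  original-realised : ∀ {i} → i < n → Realised (oldEdges G₀) O i
  original-realised {i} i<n = _ , ∈-map⁺ _ (∈-map⁺ _ (∈-allFin u)) ,
    cong₂ _,_ (trans (toℕ-↑ˡ u E) (toℕ-fromℕ< i<n))
              (trans (toℕ-↑ˡ _ E) (trans (toℕ-fromℕ< _) (cong next (toℕ-fromℕ< i<n))))
    where u = Fin.fromℕ< i<n

  A-realised : ∀ {i} → i < n → Realised (subdivEdges G₀) A i
  A-realised {i} i<n = _ , ∈-concat⁺′ (here refl) (∈-map⁺ halves (∈-allFin e)) ,
    cong₂ _,_ (trans (toℕ-↑ˡ _ E) (trans (proj₁ (cycle-ends e)) (toℕ-edgeAt i<n)))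
              (trans (toℕ-↑ʳ n e) (cong (n +_) (toℕ-edgeAt i<n)))
    where e = edgeAt i<n

  B-realised : ∀ {i} → i < n → Realised (subdivEdges G₀) B i
  B-realised {i} i<n = _ , ∈-concat⁺′ (there (here refl)) (∈-map⁺ halves (∈-allFin e)) ,
    cong₂ _,_ (trans (toℕ-↑ʳ n e) (cong (n +_) (toℕ-edgeAt i<n)))
              (trans (toℕ-↑ˡ _ E) (trans (proj₂ (cycle-ends e)) (cong next (toℕ-edgeAt i<n))))
    where e = edgeAt i<n

  line-member : ∀ e f → toℕ e < toℕ f → ShareEnd (ends G₀ e) (ends G₀ f) → (newV e , newV f) ∈ lineEdges G₀
  line-member e f e<f share =
    ∈-map⁺ _ (∈-filter⁺ (T? ∘ adjacentᵇ) (∈-cartesianProduct⁺ (∈-allFin e) (∈-allFin f))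
                        (Equivalence.from Bool.T-∧ (<⇒<ᵇ e<f , ShareEnd⇒shareᵇ G₀ share)))

  line-realised : ∀ {i} → i < n → Realised (lineEdges G₀) L i
  line-realised {i} i<n with nonlast-or-last i<n
  ... | inj₁ nonlast = _ , line-member e f e<f (inj₂ (inj₂ (inj₁ b≡c))) , eq
    where
      e = edgeAt i<n
      f = edgeAt nonlast
      e<f = subst₂ _<_ (sym (toℕ-edgeAt i<n)) (sym (toℕ-edgeAt nonlast)) (n<1+n i)
      b≡c = toℕ-injective (trans (proj₂ (cycle-ends e)) (trans (cong next (toℕ-edgeAt i<n))
                           (trans (next-nonlast nonlast) (sym (trans (proj₁ (cycle-ends f)) (toℕ-edgeAt nonlast))))))
      eq : code (newV e , newV f) ≡ endpoints L i
      eq rewrite next-nonlast nonlast | m≤n⇒m⊓n≡m (n≤1+n i) | m≤n⇒m⊔n≡n (n≤1+n i) =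
        cong₂ _,_ (trans (toℕ-↑ʳ n e) (cong (n +_) (toℕ-edgeAt i<n)))
                  (trans (toℕ-↑ʳ n f) (cong (n +_) (toℕ-edgeAt nonlast)))
  ... | inj₂ last = _ , line-member e f e<f (inj₂ (inj₁ a≡d)) , eq
    where
      e = edgeAt 0<n
      f = edgeAt i<n
      0<i : 0 < i
      0<i = subst (0 <_) (sym (suc-injective last)) z<s
      e<f = subst₂ _<_ (sym (toℕ-edgeAt 0<n)) (sym (toℕ-edgeAt i<n)) 0<i
      a≡d = toℕ-injective (trans (proj₁ (cycle-ends e)) (trans (toℕ-edgeAt 0<n)
                           (sym (trans (proj₂ (cycle-ends f)) (trans (cong next (toℕ-edgeAt i<n)) (next-last last))))))
      eq : code (newV e , newV f) ≡ endpoints L i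
      eq rewrite next-last last | ⊓-zeroʳ i | ⊔-identityʳ i =
        cong₂ _,_ (trans (toℕ-↑ʳ n e) (cong (n +_) (toℕ-edgeAt 0<n)))
                  (trans (toℕ-↑ʳ n f) (cong (n +_) (toℕ-edgeAt i<n)))

  oldV≢newV : ∀ {u e} → oldV u ≢ newV e
  oldV≢newV {u} {e} eq =
    <⇒≱ (toℕ<n u) (subst (n ≤_) (trans (sym (toℕ-↑ʳ n e)) (trans (cong toℕ (sym eq)) (toℕ-↑ˡ u E))) (m≤m+n n (toℕ e)))

  original-unique : Unique (oldEdges G₀)
  original-unique =
    Unique.map⁺ (λ eq → cong₂ _,_ (↑ˡ-injective E _ _ (,-injectiveˡ eq)) (↑ˡ-injective E _ _ (,-injectiveʳ eq)))
                      (Unique.map⁺ ,-injectiveˡ (Unique.allFin⁺ n))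

  subdivision-unique : Unique (subdivEdges G₀)
  subdivision-unique = Unique.concat⁺ (All.map⁺ (All.tabulate λ _ → halves-unique))
                                      (AllPairs.map⁺ (AllPairs.tabulate⁺ {f = id} halves-disjoint))
    where
      halves-unique : ∀ {e} → Unique (halves e)
      halves-unique = ((oldV≢newV ∘ ,-injectiveˡ) ∷ []) ∷ [] ∷ []
      halves-disjoint : ∀ {e f} → e ≢ f → Disjoint (halves e) (halves f)
      halves-disjoint e≢f (here p , here q)                 = e≢f (↑ʳ-injective n _ _ ((,-injectiveʳ (trans (sym p) q))))
      halves-disjoint e≢f (here p , there (here q))         = oldV≢newV ((,-injectiveˡ (trans (sym p) q)))
      halves-disjoint e≢f (there (here p) , here q)         = oldV≢newV (sym ((,-injectiveˡ (trans (sym p) q))))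
      halves-disjoint e≢f (there (here p) , there (here q)) = e≢f (↑ʳ-injective n _ _ ((,-injectiveˡ (trans (sym p) q))))

  line-unique : Unique (lineEdges G₀)
  line-unique =
    Unique.map⁺ (λ eq → cong₂ _,_ (↑ʳ-injective n _ _ (,-injectiveˡ eq)) (↑ʳ-injective n _ _ (,-injectiveʳ eq)))
                  (Unique.filter⁺ (T? ∘ adjacentᵇ) (Unique.cartesianProduct⁺ (Unique.allFin⁺ E) (Unique.allFin⁺ E)))

  classified-disjoint : ∀ {a b} {xs ys : List (Fin N × Fin N)} → (∀ τ → a τ ≡ true → b τ ≡ true → ⊥) →
                        (∀ {x} → x ∈ xs → Classified a x) → (∀ {x} → x ∈ ys → Classified b x) → Disjoint xs ys
  classified-disjoint a∩b=∅ classify-xs classify-ys (x∈xs , x∈ys)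
    with classify-xs x∈xs | classify-ys x∈ys
  ... | (τ , i) , i<n , aτ , eq | (τ′ , j) , j<n , bτ′ , eq′
    with refl ← endpoints-injective i<n j<n (trans (sym eq) eq′) = a∩b=∅ τ aτ bτ′

  record EdgeDescription (es : List (Fin N × Fin N)) (allowed : Kind → Bool) : Set where
    field
      classify : ∀ {x} → x ∈ es → Classified allowed x
      unique   : Unique es
      realise  : ∀ τ {i} → allowed τ ≡ true → i < n → Realised es τ i

  spinePosition : Fin N → Fin N
  spinePosition v = Fin.fromℕ< (subst (position (toℕ v) <_) (sym N≡2n) (position<2n (subst (toℕ v <_) N≡2n (toℕ<n v))))

  toℕ-spinePosition : ∀ v → toℕ (spinePosition v) ≡ position (toℕ v)
  toℕ-spinePosition v = toℕ-fromℕ< _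

  spinePosition-injective : Injective _≡_ _≡_ spinePosition
  spinePosition-injective {u} {v} eq =
    toℕ-injective (position-injective (trans (sym (toℕ-spinePosition u)) (trans (cong toℕ eq) (toℕ-spinePosition v))))

  module Described {es allowed} (description : EdgeDescription es allowed) where
    open EdgeDescription description

    G : Graph
    G = graph N es

    private
      classified : ∀ e → Classified allowed (ends G e)
      classified e = classify (∈-lookup e)

    kind : Edge G → Kind
    kind e = proj₁ (proj₁ (classified e))

    index : Edge G → ℕ
    index e = proj₂ (proj₁ (classified e))

    index<n : ∀ e → index e < n
    index<n e = proj₁ (proj₂ (classified e))

    kind-allowed : ∀ e → allowed (kind e) ≡ true
    kind-allowed e = proj₁ (proj₂ (proj₂ (classified e)))

    code-ends : ∀ e → code (ends G e) ≡ endpoints (kind e) (index e)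
    code-ends e = proj₂ (proj₂ (proj₂ (classified e)))

    label-injective : ∀ {e f} → (kind e , index e) ≡ (kind f , index f) → e ≡ f
    label-injective {e} {f} eq = Unique⇒lookup-injective unique
      (code-injective (trans (code-ends e) (trans (cong (λ (τ , i) → endpoints τ i) eq) (sym (code-ends f)))))

    touches : ∀ {v e} → Incident G v (ends G e) → Touches (toℕ v) (kind e) (index e)
    touches {e = e} (inj₁ refl) = inj₁ (cong proj₁ (code-ends e))
    touches {e = e} (inj₂ refl) = inj₂ (cong proj₂ (code-ends e))

    loopless : ∀ e → proj₁ (ends G e) ≢ proj₂ (ends G e)
    loopless e eq = endpoints-distinct (kind e) (index<n e)
      (trans (sym (cong proj₁ (code-ends e))) (trans (cong toℕ eq) (cong proj₂ (code-ends e))))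

    spine-ends : ∀ e → (toℕ (spinePosition (proj₁ (ends G e))) , toℕ (spinePosition (proj₂ (ends G e))))
                       ≡ spine (kind e) (index e)
    spine-ends e = cong₂ _,_ (trans (toℕ-spinePosition (proj₁ (ends G e))) (cong position (cong proj₁ (code-ends e))))
                             (trans (toℕ-spinePosition (proj₂ (ends G e))) (cong position (cong proj₂ (code-ends e))))

    edgeFor : ∀ τ {i} → allowed τ ≡ true → i < n → Edge G
    edgeFor τ ok i<n = Any.index (proj₁ (proj₂ (realise τ ok i<n)))

    code-edgeFor : ∀ τ {i} (ok : allowed τ ≡ true) (i<n : i < n) → code (ends G (edgeFor τ ok i<n)) ≡ endpoints τ i
    code-edgeFor τ ok i<n with realise τ ok i<n
    ... | x , x∈ , eq = trans (cong code (sym (Any.lookup-index x∈))) eq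

    star : ∀ {r c} v → toℕ v ≡ c → (ds : Fin r → Kind × ℕ) → Injective _≡_ _≡_ ds →
           (∀ q → allowed (proj₁ (ds q)) ≡ true) →
           (∀ q → proj₂ (ds q) < n × Touches c (proj₁ (ds q)) (proj₂ (ds q))) →
           Star G v r
    star v v≡c ds ds-injective ok touching = edge , edge-injective , incident
      where
        edge : Fin _ → Edge G
        edge q = edgeFor (proj₁ (ds q)) (ok q) (proj₁ (touching q))
        code-edge : ∀ q → code (ends G (edge q)) ≡ endpoints (proj₁ (ds q)) (proj₂ (ds q))
        code-edge q = code-edgeFor (proj₁ (ds q)) (ok q) (proj₁ (touching q))
        edge-injective : Injective _≡_ _≡_ edge
        edge-injective {q} {q′} eq = ds-injective (endpoints-injective (proj₁ (touching q)) (proj₁ (touching q′))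
          (trans (sym (code-edge q)) (trans (cong (code ∘ ends G) eq) (code-edge q′))))
        incident : ∀ q → Incident G v (ends G (edge q))
        incident q with proj₂ (touching q)
        ... | inj₁ c≡ = inj₁ (toℕ-injective (trans (cong proj₁ (code-edge q)) (sym (trans v≡c c≡))))
        ... | inj₂ c≡ = inj₂ (toℕ-injective (trans (cong proj₂ (code-edge q)) (sym (trans v≡c c≡))))

    module Paged {k X} (colouring : Colouring k allowed X) where
      open Colouring colouring

      page : Edge G → Fin k
      page e = colour (index e) (kind e)

      page-distinct : ∀ {e f} → Clash X (kind e) (index e) (kind f) (index f) → page e ≢ page f
      page-distinct {e} {f} = colour-distinct (kind-allowed e) (kind-allowed f) (index<n e) (index<n f)

      page-proper : (∀ τ τ′ → shareNext τ τ′ ≡ true → X τ τ′ ≡ true) → ProperEdgeColouring G page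
      page-proper share⊆X e f e≢f same share with ShareEnd⇒common G share
      ... | v , v∈e , v∈f =
        page-distinct (Clash-mono share⊆X (shared-endpoint⇒Clash (index<n e) (index<n f)
                         (e≢f ∘ label-injective) (touches v∈e) (touches v∈f))) same

      mbe : (∀ τ τ′ → shareNext τ τ′ ≡ true → X τ τ′ ≡ true) →
            (∀ {τ i τ′ j} → allowed τ ≡ true → allowed τ′ ≡ true → CrossingPair τ i τ′ j → Clash X τ i τ′ j) →
            MBE G k
      mbe share⊆X crossing⇒Clash = record
        { pos      = spinePosition
        ; pos-inj  = spinePosition-injective
        ; page     = page
        ; noCross  = λ e f same crosses → page-distinct
            (crossing⇒Clash (kind-allowed e) (kind-allowed f)
              (crossing⇒CrossingPair (kind e) (kind f) (index<n e) (index<n f)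
                (subst₂ Crosses (spine-ends e) (spine-ends f) crosses))) same
        ; matching = page-proper share⊆X
        }


  ++-description : ∀ {xs ys a b} → EdgeDescription xs a → EdgeDescription ys b →
                   (∀ τ → a τ ≡ true → b τ ≡ true → ⊥) →
                   EdgeDescription (xs ++ ys) (λ τ → a τ ∨ b τ)
  ++-description {xs} {ys} {a} {b} dx dy a∩b=∅ = record
    { classify = λ x∈ → [ Classified-weaken (λ τ aτ → cong (_∨ b τ) aτ) ∘ X.classify
                        , Classified-weaken (λ τ bτ → trans (cong (a τ ∨_) bτ) (Bool.∨-zeroʳ (a τ))) ∘ Y.classify
                        ]′ (∈-++⁻ xs x∈)
    ; unique   = Unique.++⁺ X.unique Y.unique (classified-disjoint a∩b=∅ X.classify Y.classify)
    ; realise  = realise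
    }
    where
      module X = EdgeDescription dx
      module Y = EdgeDescription dy
      realise : ∀ τ {i} → (a τ ∨ b τ) ≡ true → i < n → Realised (xs ++ ys) τ i
      realise τ ok i<n with a τ in aτ
      ... | true  = let x , x∈ , eq = X.realise τ aτ i<n in x , ∈-++⁺ˡ x∈ , eq
      ... | false = let y , y∈ , eq = Y.realise τ ok i<n in y , ∈-++⁺ʳ xs y∈ , eq

  original-description : EdgeDescription (oldEdges G₀) O-kind
  original-description = record
    { classify = original-classified ; unique = original-unique ; realise = λ { O _ → original-realised } }

  subdivision-description : EdgeDescription (subdivEdges G₀) S-kinds
  subdivision-description = record
    { classify = subdivision-classified ; unique = subdivision-unique
    ; realise = λ { A _ → A-realised ; B _ → B-realised } }

  line-description : EdgeDescription (lineEdges G₀) L-kind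
  line-description = record
    { classify = line-classified ; unique = line-unique ; realise = λ { L _ → line-realised } }

  R-description : EdgeDescription (oldEdges G₀ ++ subdivEdges G₀) R-kinds
  R-description = ++-description original-description subdivision-description λ { O _ () }

  Q-description : EdgeDescription (subdivEdges G₀ ++ lineEdges G₀) Q-kinds
  Q-description = ++-description subdivision-description line-description λ { A _ () ; B _ () }

  T-description : EdgeDescription (oldEdges G₀ ++ subdivEdges G₀ ++ lineEdges G₀) T-kinds
  T-description = ++-description original-description Q-description λ { O _ () }

  oldStar : ℕ → Fin 4 → Kind × ℕ
  oldStar c 0F = A , c
  oldStar c 1F = O , c
  oldStar c 2F = B , prev c
  oldStar c 3F = O , prev c

  newStar : ℕ → Fin 4 → Kind × ℕ
  newStar k 0F = A , k
  newStar k 1F = B , k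
  newStar k 2F = L , k
  newStar k 3F = L , prev k

  oldStar-injective : ∀ {c} → c < n → Injective _≡_ _≡_ (oldStar c)
  oldStar-injective c<n {0F} {0F} _ = refl
  oldStar-injective c<n {1F} {1F} _ = refl
  oldStar-injective c<n {2F} {2F} _ = refl
  oldStar-injective c<n {3F} {3F} _ = refl
  oldStar-injective c<n {1F} {3F} eq = ⊥-elim (prev≢id c<n (sym (cong proj₂ eq)))
  oldStar-injective c<n {3F} {1F} eq = ⊥-elim (prev≢id c<n (cong proj₂ eq))
  oldStar-injective c<n {0F} {1F} ()
  oldStar-injective c<n {0F} {2F} ()
  oldStar-injective c<n {0F} {3F} ()
  oldStar-injective c<n {1F} {0F} ()
  oldStar-injective c<n {1F} {2F} ()
  oldStar-injective c<n {2F} {0F} ()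
  oldStar-injective c<n {2F} {1F} ()
  oldStar-injective c<n {2F} {3F} ()
  oldStar-injective c<n {3F} {0F} ()
  oldStar-injective c<n {3F} {2F} ()

  newStar-injective : ∀ {k} → k < n → Injective _≡_ _≡_ (newStar k)
  newStar-injective k<n {0F} {0F} _ = refl
  newStar-injective k<n {1F} {1F} _ = refl
  newStar-injective k<n {2F} {2F} _ = refl
  newStar-injective k<n {3F} {3F} _ = refl
  newStar-injective k<n {2F} {3F} eq = ⊥-elim (prev≢id k<n (sym (cong proj₂ eq)))
  newStar-injective k<n {3F} {2F} eq = ⊥-elim (prev≢id k<n (cong proj₂ eq))
  newStar-injective k<n {0F} {1F} ()
  newStar-injective k<n {0F} {2F} ()
  newStar-injective k<n {0F} {3F} ()
  newStar-injective k<n {1F} {0F} ()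
  newStar-injective k<n {1F} {2F} ()
  newStar-injective k<n {1F} {3F} ()
  newStar-injective k<n {2F} {0F} ()
  newStar-injective k<n {2F} {1F} ()
  newStar-injective k<n {3F} {0F} ()
  newStar-injective k<n {3F} {1F} ()

  touches-L : ∀ {k j} → next j ≡ k ⊎ j ≡ k → Touches (n + k) L j
  touches-L {k} {j} hit with ≤-total j (next j)
  ... | inj₁ j≤ = by-hit hit
    where
      by-hit : next j ≡ k ⊎ j ≡ k → Touches (n + k) L j
      by-hit (inj₁ refl) = inj₂ (cong (n +_) (sym (m≤n⇒m⊔n≡n j≤)))
      by-hit (inj₂ refl) = inj₁ (cong (n +_) (sym (m≤n⇒m⊓n≡m j≤)))
  ... | inj₂ ≥j = by-hit hit
    where
      by-hit : next j ≡ k ⊎ j ≡ k → Touches (n + k) L j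
      by-hit (inj₁ refl) = inj₁ (cong (n +_) (sym (m≥n⇒m⊓n≡n ≥j)))
      by-hit (inj₂ refl) = inj₂ (cong (n +_) (sym (m≥n⇒m⊔n≡m ≥j)))

  oldStar-touches : ∀ {c} → c < n → ∀ q →
                    proj₂ (oldStar c q) < n × Touches c (proj₁ (oldStar c q)) (proj₂ (oldStar c q))
  oldStar-touches c<n 0F = c<n , inj₁ refl
  oldStar-touches c<n 1F = c<n , inj₁ refl
  oldStar-touches c<n 2F = prev<n c<n , inj₂ (sym (next-prev c<n))
  oldStar-touches c<n 3F = prev<n c<n , inj₂ (sym (next-prev c<n))

  newStar-touches : ∀ {k} → k < n → ∀ q →
                    proj₂ (newStar k q) < n × Touches (n + k) (proj₁ (newStar k q)) (proj₂ (newStar k q))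
  newStar-touches k<n 0F = k<n , inj₂ refl
  newStar-touches k<n 1F = k<n , inj₁ refl
  newStar-touches k<n 2F = k<n , touches-L (inj₂ refl)
  newStar-touches k<n 3F = prev<n k<n , touches-L (inj₁ (next-prev k<n))

  only-O-and-L-cross : ∀ {allowed : Kind → Bool} {X} → (allowed O ≡ true → allowed L ≡ true → ⊥) →
                       ∀ {τ i τ′ j} → allowed τ ≡ true → allowed τ′ ≡ true → CrossingPair τ i τ′ j → Clash X τ i τ′ j
  only-O-and-L-cross no-O-L okτ okτ′ pair with CrossingPair-kinds pair
  ... | inj₁ (refl , refl) = ⊥-elim (no-O-L okτ okτ′)
  ... | inj₂ (refl , refl) = ⊥-elim (no-O-L okτ′ okτ)

  old-vertex : ∀ {c} → c < n → ∃[ v ] toℕ {N} v ≡ c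
  old-vertex c<n = oldV (Fin.fromℕ< c<n) , trans (toℕ-↑ˡ _ E) (toℕ-fromℕ< c<n)

  new-vertex : ∀ {k} → k < n → ∃[ v ] toℕ {N} v ≡ n + k
  new-vertex k<n = newV (edgeAt k<n) , trans (toℕ-↑ʳ n _) (cong (n +_) (toℕ-edgeAt k<n))

  vertex-kind : ∀ (v : Fin N) → (∃[ c ] c < n × toℕ v ≡ c) ⊎ (∃[ k ] k < n × toℕ v ≡ n + k)
  vertex-kind v with toℕ v <? n
  ... | yes v<n = inj₁ (toℕ v , v<n , refl)
  ... | no v≮n = inj₂ (toℕ v ∸ n , +-cancelˡ-< n _ _ (subst (_< n + n) (sym n+[v∸n]≡v) v<2n) , sym n+[v∸n]≡v)
    where
      n+[v∸n]≡v : n + (toℕ v ∸ n) ≡ toℕ v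
      n+[v∸n]≡v = m+[n∸m]≡n (≮⇒≥ v≮n)
      v<2n : toℕ v < n + n
      v<2n = subst (toℕ v <_) (trans N≡2n (cong (n +_) (+-identityʳ n))) (toℕ<n v)

  module S′ = Described subdivision-description
  module R′ = Described R-description
  module Q′ = Described Q-description
  module T′ = Described T-description

  S-mbe : MBE (S G₀) 2
  S-mbe = S′.Paged.mbe (colouring twoColours) (λ _ _ x → x) (only-O-and-L-cross {S-kinds} λ ())

  R-mbe : MBE (R G₀) 4
  R-mbe = R′.Paged.mbe (Colouring.restrict (colouring fourColours) (λ τ _ → T-kinds-all τ)) (λ _ _ x → x)
                       (only-O-and-L-cross {R-kinds} λ _ ())

  Q-mbe : MBE (Q G₀) 4
  Q-mbe = Q′.Paged.mbe (Colouring.restrict (colouring fourColours) (λ τ _ → T-kinds-all τ)) (λ _ _ x → x)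
                       (only-O-and-L-cross {Q-kinds} λ ())

  T-mbe : MBE (T G₀) 5
  T-mbe = T′.Paged.mbe (colouring fiveColours) shareNext⊆conflictNext (λ _ _ → CrossingPair⇒Clash)

  T-proper-colouring₄ : ProperEdgeColouring (T G₀) (T′.Paged.page (colouring fourColours))
  T-proper-colouring₄ = T′.Paged.page-proper (colouring fourColours) (λ _ _ x → x)

  S-star : Star (S G₀) (proj₁ (new-vertex 0<n)) 2
  S-star = S′.star _ (proj₂ (new-vertex 0<n)) subdivisionStar injective (λ { 0F → refl ; 1F → refl })
                   (λ { 0F → 0<n , inj₂ refl ; 1F → 0<n , inj₁ refl })
    where
      subdivisionStar : Fin 2 → Kind × ℕ
      subdivisionStar 0F = A , 0
      subdivisionStar 1F = B , 0
      injective : Injective _≡_ _≡_ subdivisionStar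
      injective {0F} {0F} _ = refl
      injective {1F} {1F} _ = refl
      injective {0F} {1F} ()
      injective {1F} {0F} ()

  R-star : Star (R G₀) (proj₁ (old-vertex 0<n)) 4
  R-star = R′.star _ (proj₂ (old-vertex 0<n)) (oldStar 0) (oldStar-injective 0<n)
                   (λ { 0F → refl ; 1F → refl ; 2F → refl ; 3F → refl }) (oldStar-touches 0<n)

  Q-star : Star (Q G₀) (proj₁ (new-vertex 0<n)) 4
  Q-star = Q′.star _ (proj₂ (new-vertex 0<n)) (newStar 0) (newStar-injective 0<n)
                   (λ { 0F → refl ; 1F → refl ; 2F → refl ; 3F → refl }) (newStar-touches 0<n)

  T-star : ∀ v → Star (T G₀) v 4
  T-star v with vertex-kind v
  ... | inj₁ (c , c<n , v≡c) =
    T′.star v v≡c (oldStar c) (oldStar-injective c<n) (T-kinds-all ∘ proj₁ ∘ oldStar c) (oldStar-touches c<n)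
  ... | inj₂ (k , k<n , v≡k) =
    T′.star v v≡k (newStar k) (newStar-injective k<n) (T-kinds-all ∘ proj₁ ∘ newStar k) (newStar-touches k<n)

  T-no-4-pages : ¬ MBE (T G₀) 4
  T-no-4-pages mb = regular-mbe⇒no-triangle (T G₀) mb T-star T′.loopless eA eB eO
    (toℕ-injective (trans (cong proj₁ code-A) (sym (cong proj₁ code-O))))
    (toℕ-injective (trans (cong proj₂ code-A) (sym (cong proj₁ code-B))))
    (toℕ-injective (trans (cong proj₂ code-B) (sym (cong proj₂ code-O))))
    where
      eA = T′.edgeFor A refl 0<n
      eB = T′.edgeFor B refl 0<n
      eO = T′.edgeFor O refl 0<n
      code-A : code (ends (T G₀) eA) ≡ endpoints A 0
      code-A = T′.code-edgeFor A refl 0<n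
      code-B : code (ends (T G₀) eB) ≡ endpoints B 0
      code-B = T′.code-edgeFor B refl 0<n
      code-O : code (ends (T G₀) eO) ≡ endpoints O 0
      code-O = T′.code-edgeFor O refl 0<n

  S-dispersable : Dispersable (S G₀)
  S-dispersable = mbe+star⇒dispersable (S G₀) S-mbe S-star

  R-dispersable : Dispersable (R G₀)
  R-dispersable = mbe+star⇒dispersable (R G₀) R-mbe R-star

  Q-dispersable : Dispersable (Q G₀)
  Q-dispersable = mbe+star⇒dispersable (Q G₀) Q-mbe Q-star

  T-nearlyDispersable : NearlyDispersable (T G₀)
  T-nearlyDispersable =
    mbe+star+colouring⇒nearlyDispersable (T G₀) T-mbe (T-star (proj₁ (old-vertex 0<n))) T-proper-colouring₄ T-no-4-pages

corollary3p2 : (n : ℕ) → 3 ≤ n →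
    Dispersable (S (C n)) × Dispersable (Q (C n)) × Dispersable (R (C n))
      × NearlyDispersable (T (C n))
corollary3p2 (suc (suc (suc m))) (s≤s (s≤s (s≤s _))) =
  S-dispersable , Q-dispersable , R-dispersable , T-nearlyDispersable
  where open Construction m
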